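{- Let $(G,\mathcal{L})$ be an instance of List Coloring where $G$ has $n$ vertices and each list satisfies $L(v)\subseteq\{2,\dots,n^2+1\}$. Let $t=\max\bigcup_{v\in V(G)}L(v)$ and $N=n^3+n^2-n$. Construct $H$ from $G$ as follows: add a new vertex $z$, and for each $i\in\{1,\dots,N\}$ add two new vertices $a_i,b_i$ with edges $za_i,zb_i,a_ib_i$ and attach $N+i-1$ suspended paths to each of $a_i$ and $b_i$; for each $v\in V(G)$ and each $k\in\{1,\dots,t+n-1\}\setminus(L(v)\cup\{1\})$ add a new path $v,x^{v,k}_1,\dots,x^{v,k}_{N-k},z$ in which $x^{v,k}_i$ has $k+i-1$ suspended paths attached; attach $t-2$ pendant vertices to each $v\in V(G)$; and attach two suspended paths to each $v\in V(G)$. Then $(G,\mathcal{L})$ is a yes-instance of List Coloring if and only if $H$ admits a proper weight function $w:E(H)\to\{0,1\}$.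
   Context: Graphs are finite, simple, undirected. List Coloring: given a graph $G$ and a list $L(v)$ of colors for each vertex, decide whether there is a proper coloring $c$ of $G$ with $c(v)\in L(v)$ for all $v$. For $w:E(H)\to\{0,1\}$, $\mathrm{color}_w(u)=\sum_{e\ni u}w(e)$; $w$ is proper if $\mathrm{color}_w(u)\neq\mathrm{color}_w(u')$ for every edge $uu'$. Attaching a suspended path at a vertex $a$ means adding two new vertices $c,d$ and edges $ac,cd$, where $c,d$ have no other neighbors; a pendant vertex attached to $a$ is a new vertex adjacent only to $a$. All added vertices are distinct and new. -}

module Defs where

open import Data.Nat using (ℕ; zero; suc; _+_; _*_; _∸_; _^_; _≤_; _⊔_; _≡ᵇ_; _<ᵇ_)
open import Data.Nat.Properties using () renaming (_≟_ to _≟ℕ_)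
open import Data.Bool using (Bool; true; false; _∧_; _∨_; not; if_then_else_)
open import Data.Fin using (Fin; toℕ)
open import Data.List using (List; []; _∷_; _++_; map; concatMap; foldr; filterᵇ; upTo; allFin)
open import Data.List.Properties using (≡-dec)
open import Data.List.Membership.Propositional using (_∈_)
open import Data.Product using (_×_; _,_; ∃)
open import Relation.Nullary using (¬_; Dec; yes; no)
open import Relation.Binary.PropositionalEquality using (_≡_; _≢_)

record Graph (n : ℕ) : Set where
  field
    adj    : Fin n → Fin n → Bool
    sym    : ∀ u v → adj u v ≡ adj v u
    irrefl : ∀ v → adj v v ≡ false
open Graph public

ListAssignment : ℕ → Set
ListAssignment n = Fin n → List ℕ

IsListColoring : ∀ {n} → Graph n → ListAssignment n → (Fin n → ℕ) → Set
IsListColoring G L c =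
  (∀ v → c v ∈ L v) × (∀ u v → adj G u v ≡ true → c u ≢ c v)

ListColorable : ∀ {n} → Graph n → ListAssignment n → Set
ListColorable G L = ∃ λ c → IsListColoring G L c

-- Graphs given by an edge list (each edge listed once, as an ordered pair)

Vtx : Set
Vtx = List ℕ

_≟V_ : (x y : Vtx) → Dec (x ≡ y)
_≟V_ = ≡-dec _≟ℕ_

Edge : Set
Edge = Vtx × Vtx

isYes : ∀ {P : Set} → Dec P → Bool
isYes (yes _) = true
isYes (no _)  = false

bit : Bool → ℕ
bit true  = 1
bit false = 0

colorW : List Edge → (Edge → Bool) → Vtx → ℕ
colorW [] w u = 0
colorW ((x , y) ∷ es) w u =
  (if isYes (u ≟V x) ∨ isYes (u ≟V y) then bit (w (x , y)) else 0) + colorW es w u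

ProperWeighting : List Edge → (Edge → Bool) → Set
ProperWeighting E w = ∀ {x y} → (x , y) ∈ E → colorW E w x ≢ colorW E w y

HasProperWeighting : List Edge → Set
HasProperWeighting E = ∃ λ w → ProperWeighting E w

-- Vertex names of H (prefix codes, pairwise distinct)

vG : ∀ {n} → Fin n → Vtx
vG v = 0 ∷ toℕ v ∷ []

vZ : Vtx
vZ = 1 ∷ []

vA vB : ℕ → Vtx
vA i = 2 ∷ i ∷ []
vB i = 3 ∷ i ∷ []

vX : ∀ {n} → Fin n → ℕ → ℕ → Vtx
vX v k i = 4 ∷ toℕ v ∷ k ∷ i ∷ []

vPend vC vD : Vtx → ℕ → Vtx
vPend h j = 5 ∷ j ∷ h
vC h j = 6 ∷ j ∷ h
vD h j = 7 ∷ j ∷ h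

-- [a .. b] (empty if b < a)
range : ℕ → ℕ → List ℕ
range a b = map (a +_) (upTo (suc b ∸ a))

suspendedPaths : Vtx → ℕ → List Edge
suspendedPaths h m = concatMap (λ j → (h , vC h j) ∷ (vC h j , vD h j) ∷ []) (upTo m)

pendants : Vtx → ℕ → List Edge
pendants h m = map (λ j → (h , vPend h j)) (upTo m)

pathEdges : Vtx → List Vtx → Vtx → List Edge
pathEdges s []       e = (s , e) ∷ []
pathEdges s (x ∷ xs) e = (s , x) ∷ pathEdges x xs e

elemᵇ : ℕ → List ℕ → Bool
elemᵇ k []       = false
elemᵇ k (x ∷ xs) = (k ≡ᵇ x) ∨ elemᵇ k xs

bigN : ℕ → ℕ
bigN n = n ^ 3 + n ^ 2 ∸ n

tMax : ∀ {n} → ListAssignment n → ℕ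
tMax {n} L = foldr _⊔_ 0 (concatMap L (allFin n))

module Construction {n : ℕ} (G : Graph n) (L : ListAssignment n) where

  N t : ℕ
  N = bigN n
  t = tMax L

  edgesG : List Edge
  edgesG = concatMap (λ u → concatMap (λ v →
             if adj G u v ∧ (toℕ u <ᵇ toℕ v) then (vG u , vG v) ∷ [] else [])
             (allFin n)) (allFin n)

  gadget : ℕ → List Edge
  gadget i = (vZ , vA i) ∷ (vZ , vB i) ∷ (vA i , vB i) ∷
             (suspendedPaths (vA i) (N + i ∸ 1) ++ suspendedPaths (vB i) (N + i ∸ 1))

  missing : Fin n → List ℕ
  missing v = filterᵇ (λ k → not (elemᵇ k (L v))) (range 2 (t + n ∸ 1))

  xPath : Fin n → ℕ → List Edge
  xPath v k =
    pathEdges (vG v) (map (vX v k) (range 1 (N ∸ k))) vZ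
    ++ concatMap (λ i → suspendedPaths (vX v k i) (k + i ∸ 1)) (range 1 (N ∸ k))

  vertexGadget : Fin n → List Edge
  vertexGadget v = pendants (vG v) (t ∸ 2) ++ suspendedPaths (vG v) 2

  edgesH : List Edge
  edgesH = edgesG
        ++ concatMap gadget (range 1 N)
        ++ concatMap (λ v → concatMap (xPath v) (missing v)) (allFin n)
        ++ concatMap vertexGadget (allFin n)

edgesH : ∀ {n} → Graph n → ListAssignment n → List Edge
edgesH G L = Construction.edgesH G L

{-# OPTIONS --safe #-}
module Submission where

-- A proper weighting w of H forces the colour of every vertex. A suspended path at h must
-- carry weight on its edge at h (otherwise its two new vertices get the same colour), so the
-- suspended paths at h add exactly their number to the colour of h. In the triangle z a_i b_i
-- the vertices a_i and b_i then differ only in their edges to z: exactly one of these edges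
-- carries weight, and a_i or b_i gets colour N + i. So z has colour N + j, where j ≤ N counts
-- the weighted path edges at z, and j = 0 because z is adjacent to a vertex of colour N + j.
-- Walking back from z along the path v, x_1, …, x_{N-k}, z forces weight 0 on all its edges
-- and colour k + i - 1 on x_i, so v does not get colour k. Its two suspended paths, t - 2
-- pendant vertices and at most n - 1 edges of G keep the colour of v within 2, …, t + n - 1,
-- hence in L(v): the colours of the vertices of G form an L-colouring. Conversely, an
-- L-colouring c is realised by putting weight on the edges z a_i and a_i b_i, on the hub edge
-- of every suspended path, and on c(v) - 2 pendant edges at each vertex v of G.

open import Algebra.Properties.CommutativeSemigroup using (interchange)
open import Data.Bool using (Bool; true; false; T; T?; not; _∧_; _∨_; if_then_else_)
open import Data.Bool.Properties using (T-∨; T-∧; T-≡)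
open import Data.Empty using (⊥; ⊥-elim)
open import Data.Fin using (Fin; toℕ; fromℕ<)
import Data.Fin.Properties as Fin
open import Data.Fin.Properties using (toℕ-injective)
open import Data.List using (List; []; _∷_; _++_; map; concatMap; length; upTo; applyUpTo; foldr; drop; _∷ʳ_; allFin)
open import Data.List.Membership.Propositional using (_∈_; _∉_; find; lose)
open import Data.List.Membership.Propositional.Properties
open import Data.List.Properties using (∷-injectiveˡ; length-filter; length-tabulate; applyUpTo-∷ʳ; length-map; length-upTo; map-applyUpTo)
open import Data.List.Relation.Binary.Subset.Propositional using (_⊆_)
open import Data.List.Relation.Unary.All as All using (All; []; _∷_)
open import Data.List.Relation.Unary.All.Properties using (concat⁺; map⁺; applyUpTo⁺₂; ++⁺)
open import Data.List.Relation.Unary.AllPairs using (_∷_)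
open import Data.List.Relation.Unary.Any using (here; there)
open import Data.List.Relation.Unary.Unique.Propositional using (Unique)
open import Data.List.Relation.Unary.Unique.Propositional.Properties as Unique using (upTo⁺; applyUpTo⁺₁)
open import Data.Nat using (ℕ; zero; suc; _+_; _*_; _∸_; _^_; _≤_; _<_; _⊓_; _⊔_; _<ᵇ_; _≡ᵇ_; z≤n; s≤s; s≤s⁻¹; z<s; s<s)
open import Data.Nat.Properties
open import Data.Product using (_×_; _,_; ∃; proj₁; proj₂)
open import Data.Sum using (_⊎_; inj₁; inj₂; map₂)
open import Defs hiding (sym)
open import Function using (_∘_; id)
open import Function.Bundles using (Equivalence; _⇔_; mk⇔)
open import Relation.Binary.Definitions using (tri<; tri≈; tri>)
open import Relation.Binary.PropositionalEquality
open import Relation.Nullary using (¬_; yes; no; does)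
open import Relation.Nullary.Decidable using (dec-true; dec-false)

bit≤1 : ∀ b → bit b ≤ 1
bit≤1 true  = s≤s z≤n
bit≤1 false = z≤n

bit≡0⇒false : ∀ {b} → bit b ≡ 0 → b ≡ false
bit≡0⇒false {false} _ = refl

sumOver : ∀ {A : Set} → List A → (A → ℕ) → ℕ
sumOver []       f = 0
sumOver (x ∷ xs) f = f x + sumOver xs f

module _ {A : Set} where

  sumOver-cong : ∀ xs {f g : A → ℕ} → (∀ x → x ∈ xs → f x ≡ g x) → sumOver xs f ≡ sumOver xs g
  sumOver-cong []       eq = refl
  sumOver-cong (x ∷ xs) eq = cong₂ _+_ (eq x (here refl)) (sumOver-cong xs (λ y → eq y ∘ there))

  sumOver-mono-≤ : ∀ xs {f g : A → ℕ} → (∀ x → x ∈ xs → f x ≤ g x) → sumOver xs f ≤ sumOver xs g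
  sumOver-mono-≤ []       le = z≤n
  sumOver-mono-≤ (x ∷ xs) le = +-mono-≤ (le x (here refl)) (sumOver-mono-≤ xs (λ y → le y ∘ there))

  sumOver-+ : ∀ xs (f g : A → ℕ) → sumOver xs (λ x → f x + g x) ≡ sumOver xs f + sumOver xs g
  sumOver-+ []       f g = refl
  sumOver-+ (x ∷ xs) f g =
    trans (cong (f x + g x +_) (sumOver-+ xs f g)) (interchange +-commutativeSemigroup (f x) (g x) (sumOver xs f) (sumOver xs g))

  sumOver-++ : ∀ xs ys (f : A → ℕ) → sumOver (xs ++ ys) f ≡ sumOver xs f + sumOver ys f
  sumOver-++ []       ys f = refl
  sumOver-++ (x ∷ xs) ys f = trans (cong (f x +_) (sumOver-++ xs ys f)) (sym (+-assoc (f x) _ _))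

  sumOver-const : ∀ xs {f : A → ℕ} c → (∀ x → x ∈ xs → f x ≡ c) → sumOver xs f ≡ length xs * c
  sumOver-const []       c eq = refl
  sumOver-const (x ∷ xs) c eq = cong₂ _+_ (eq x (here refl)) (sumOver-const xs c (λ y → eq y ∘ there))

  sumOver-zero : ∀ xs {f : A → ℕ} → (∀ x → x ∈ xs → f x ≡ 0) → sumOver xs f ≡ 0
  sumOver-zero xs eq = trans (sumOver-const xs 0 eq) (*-zeroʳ (length xs))

  sumOver-single : ∀ {xs} {f : A → ℕ} {x} → Unique xs → x ∈ xs →
                   (∀ y → y ∈ xs → y ≢ x → f y ≡ 0) → sumOver xs f ≡ f x
  sumOver-single {x ∷ xs} {f} (x∉xs ∷ _) (here refl) others =
    trans (cong (f x +_) (sumOver-zero xs (λ y y∈xs → others y (there y∈xs) (λ { refl → All.lookup x∉xs y∈xs refl }))))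
          (+-identityʳ (f x))
  sumOver-single {y ∷ xs} (y∉xs ∷ unique) (there x∈xs) others =
    cong₂ _+_ (others y (here refl) (λ { refl → All.lookup y∉xs x∈xs refl }))
              (sumOver-single unique x∈xs (λ z → others z ∘ there))

  sumOver≡0⇒ : ∀ xs {f : A → ℕ} → sumOver xs f ≡ 0 → ∀ {x} → x ∈ xs → f x ≡ 0
  sumOver≡0⇒ (y ∷ xs) {f} eq (here refl) = m+n≡0⇒m≡0 (f y) eq
  sumOver≡0⇒ (y ∷ xs) {f} eq (there x∈xs) = sumOver≡0⇒ xs (m+n≡0⇒n≡0 (f y) eq) x∈xs

  sumOver-bit≤length : ∀ xs (p : A → Bool) → sumOver xs (bit ∘ p) ≤ length xs
  sumOver-bit≤length []       p = z≤n
  sumOver-bit≤length (x ∷ xs) p = +-mono-≤ (bit≤1 (p x)) (sumOver-bit≤length xs p)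

  sumOver-bit-true : ∀ xs {p : A → Bool} → (∀ x → x ∈ xs → p x ≡ true) → sumOver xs (bit ∘ p) ≡ length xs
  sumOver-bit-true xs all-true =
    trans (sumOver-const xs 1 (λ x → cong bit ∘ all-true x)) (*-identityʳ (length xs))

sumOver-upTo-<ᵇ : ∀ m a → sumOver (upTo m) (λ j → bit (j <ᵇ a)) ≡ m ⊓ a
sumOver-upTo-<ᵇ zero    a = refl
sumOver-upTo-<ᵇ (suc m) a = begin
  sumOver (upTo (suc m)) count               ≡⟨ cong (λ js → sumOver js count) (applyUpTo-∷ʳ id m) ⟨
  sumOver (upTo m ∷ʳ m) count                ≡⟨ sumOver-++ (upTo m) (m ∷ []) count ⟩
  sumOver (upTo m) count + (bit (m <ᵇ a) + 0) ≡⟨ cong₂ _+_ (sumOver-upTo-<ᵇ m a) (+-identityʳ _) ⟩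
  m ⊓ a + bit (m <ᵇ a)                        ≡⟨ step ⟩
  suc m ⊓ a                                   ∎
  where
  open ≡-Reasoning
  count = λ j → bit (j <ᵇ a)
  step : m ⊓ a + bit (m <ᵇ a) ≡ suc m ⊓ a
  step with m <ᵇ a in m<ᵇa
  ... | true  = let m<a = <ᵇ⇒< m a (subst T (sym m<ᵇa) _) in
    trans (cong (_+ 1) (m≤n⇒m⊓n≡m (<⇒≤ m<a))) (trans (+-comm m 1) (sym (m≤n⇒m⊓n≡m m<a)))
  ... | false = let a≤m = ≮⇒≥ (λ m<a → subst T m<ᵇa (<⇒<ᵇ m<a)) in
    trans (+-identityʳ _) (trans (m≥n⇒m⊓n≡n a≤m) (sym (m≥n⇒m⊓n≡n (m≤n⇒m≤1+n a≤m))))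

≡ᵇ-refl : ∀ i → T (i ≡ᵇ i)
≡ᵇ-refl i = ≡⇒≡ᵇ i i refl

∈-range⁺ : ∀ {a b i} → a ≤ i → i ≤ b → i ∈ range a b
∈-range⁺ {a} {b} {i} a≤i i≤b =
  subst (_∈ range a b) (m+[n∸m]≡n a≤i) (∈-map⁺ (a +_) (∈-upTo⁺ (∸-monoˡ-< (s≤s i≤b) a≤i)))

∈-range⁻ : ∀ {a b i} → i ∈ range a b → a ≤ i × i ≤ b
∈-range⁻ {a} {b} i∈ with ∈-map⁻ (a +_) i∈
... | j , j∈ , refl = m≤m+n a j , a+j≤b
  where
  j<1+b∸a = ∈-upTo⁻ j∈
  a+j≤b : a + j ≤ b
  a+j≤b = s≤s⁻¹ (subst (_≤ suc b) (cong suc (+-comm j a))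
                  (m≤o∸n⇒m+n≤o (suc j) (<⇒≤ (m∸n≢0⇒n<m (m<n⇒n≢0 j<1+b∸a))) j<1+b∸a))

range-unique : ∀ a b → Unique (range a b)
range-unique a b = Unique.map⁺ (+-cancelˡ-≡ a _ _) (upTo⁺ _)

length-range : ∀ a b → length (range a b) ≡ suc b ∸ a
length-range a b = trans (length-map (a +_) (upTo (suc b ∸ a))) (length-upTo (suc b ∸ a))

elemᵇ⇒∈ : ∀ k xs → T (elemᵇ k xs) → k ∈ xs
elemᵇ⇒∈ k (x ∷ xs) t with k ≡ᵇ x in k≡ᵇx
... | true  = here (≡ᵇ⇒≡ k x (subst T (sym k≡ᵇx) _))
... | false = there (elemᵇ⇒∈ k xs t)

∈⇒elemᵇ : ∀ {k xs} → k ∈ xs → T (elemᵇ k xs)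
∈⇒elemᵇ {k} (here refl) = T-∨ .Equivalence.from (inj₁ (≡ᵇ-refl k))
∈⇒elemᵇ {k} {x ∷ _} (there k∈xs) = T-∨ .Equivalence.from (inj₂ (∈⇒elemᵇ k∈xs))

T-not⇒¬T : ∀ {b} → T (not b) → ¬ T b
T-not⇒¬T {false} _ ()

¬T⇒T-not : ∀ {b} → ¬ T b → T (not b)
¬T⇒T-not {true}  ¬t = ¬t _
¬T⇒T-not {false} _  = _

≢[]⇒∃∈ : ∀ {A : Set} {xs : List A} → xs ≢ [] → ∃ λ x → x ∈ xs
≢[]⇒∃∈ {xs = []}    xs≢[] = ⊥-elim (xs≢[] refl)
≢[]⇒∃∈ {xs = x ∷ _} _     = x , here refl

≤-foldr-⊔ : ∀ {x xs} → x ∈ xs → x ≤ foldr _⊔_ 0 xs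
≤-foldr-⊔ {x} (here refl) = m≤m⊔n x _
≤-foldr-⊔ {xs = y ∷ _} (there x∈xs) = ≤-trans (≤-foldr-⊔ x∈xs) (m≤n⊔m y _)

foldr-⊔-≤ : ∀ {xs b} → All (_≤ b) xs → foldr _⊔_ 0 xs ≤ b
foldr-⊔-≤ []           = z≤n
foldr-⊔-≤ (x≤b ∷ xs≤b) = ⊔-lub x≤b (foldr-⊔-≤ xs≤b)

incidentWeight : (Edge → Bool) → Vtx → Edge → ℕ
incidentWeight w u (x , y) = if isYes (u ≟V x) ∨ isYes (u ≟V y) then bit (w (x , y)) else 0

colorW≡sumOver : ∀ E w u → colorW E w u ≡ sumOver E (incidentWeight w u)
colorW≡sumOver []            w u = refl
colorW≡sumOver ((x , y) ∷ E) w u = cong (incidentWeight w u (x , y) +_) (colorW≡sumOver E w u)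

module _ (w : Edge → Bool) {u : Vtx} where

  incidentWeight-≢ : ∀ {x y} → u ≢ x → u ≢ y → incidentWeight w u (x , y) ≡ 0
  incidentWeight-≢ {x} {y} u≢x u≢y with u ≟V x | u ≟V y
  ... | yes u≡x | _       = ⊥-elim (u≢x u≡x)
  ... | no _    | yes u≡y = ⊥-elim (u≢y u≡y)
  ... | no _    | no _    = refl

  incidentWeight-source : ∀ {y} → incidentWeight w u (u , y) ≡ bit (w (u , y))
  incidentWeight-source with u ≟V u
  ... | yes _   = refl
  ... | no u≢u  = ⊥-elim (u≢u refl)

  incidentWeight-target : ∀ {x} → incidentWeight w u (x , u) ≡ bit (w (x , u))
  incidentWeight-target {x} with u ≟V x | u ≟V u
  ... | yes _ | _      = refl
  ... | no _  | yes _  = refl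
  ... | no _  | no u≢u = ⊥-elim (u≢u refl)

  incidentWeight-false : ∀ {e} → w e ≡ false → incidentWeight w u e ≡ 0
  incidentWeight-false {x , y} w≡false with isYes (u ≟V x) ∨ isYes (u ≟V y)
  ... | true  = cong bit w≡false
  ... | false = refl

  colorW-++ : ∀ E F → colorW (E ++ F) w u ≡ colorW E w u + colorW F w u
  colorW-++ E F = begin
    colorW (E ++ F) w u                  ≡⟨ colorW≡sumOver (E ++ F) w u ⟩
    sumOver (E ++ F) (incidentWeight w u) ≡⟨ sumOver-++ E F _ ⟩
    sumOver E _ + sumOver F _             ≡⟨ cong₂ _+_ (colorW≡sumOver E w u) (colorW≡sumOver F w u) ⟨
    colorW E w u + colorW F w u          ∎
    where open ≡-Reasoning

  colorW-concatMap : ∀ {A : Set} (f : A → List Edge) xs →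
                     colorW (concatMap f xs) w u ≡ sumOver xs (λ x → colorW (f x) w u)
  colorW-concatMap f []       = refl
  colorW-concatMap f (x ∷ xs) = trans (colorW-++ (f x) (concatMap f xs)) (cong (colorW (f x) w u +_) (colorW-concatMap f xs))

  colorW-map : ∀ {A : Set} (f : A → Edge) xs → colorW (map f xs) w u ≡ sumOver xs (incidentWeight w u ∘ f)
  colorW-map f xs = trans (colorW≡sumOver (map f xs) w u) (sumOver-map xs)
    where
    sumOver-map : ∀ xs → sumOver (map f xs) (incidentWeight w u) ≡ sumOver xs (incidentWeight w u ∘ f)
    sumOver-map []       = refl
    sumOver-map (x ∷ xs) = cong (incidentWeight w u (f x) +_) (sumOver-map xs)

  colorW-≡0 : ∀ E → (∀ {e} → e ∈ E → incidentWeight w u e ≡ 0) → colorW E w u ≡ 0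
  colorW-≡0 E zero-at = trans (colorW≡sumOver E w u) (sumOver-zero E (λ e → zero-at))

Within : (Vtx → Bool) → List Edge → Set
Within P = All (λ e → T (P (proj₁ e)) × T (P (proj₂ e)))

colorW-outside : ∀ {P E} w {u} → Within P E → ¬ T (P u) → colorW E w u ≡ 0
colorW-outside {P} {E} w {u} within u∉P = colorW-≡0 w E outside
  where
  outside : ∀ {e} → e ∈ E → incidentWeight w u e ≡ 0
  outside {x , y} e∈E with All.lookup within e∈E
  ... | Px , Py = incidentWeight-≢ w {u} (λ { refl → u∉P Px }) (λ { refl → u∉P Py })

module _ (w : Edge → Bool) {u : Vtx} {A : Set} (f : A → List Edge) where

  colorW-concatMap-single : ∀ {xs x} → Unique xs → x ∈ xs → (∀ y → y ∈ xs → y ≢ x → colorW (f y) w u ≡ 0) →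
                            colorW (concatMap f xs) w u ≡ colorW (f x) w u
  colorW-concatMap-single {xs} unique x∈xs others = trans (colorW-concatMap w f xs) (sumOver-single unique x∈xs others)

  colorW-concatMap-outside : ∀ {P : A → Vtx → Bool} xs → (∀ y → Within (P y) (f y)) → (∀ y → ¬ T (P y u)) →
                             colorW (concatMap f xs) w u ≡ 0
  colorW-concatMap-outside xs within u∉P =
    trans (colorW-concatMap w f xs) (sumOver-zero xs (λ y _ → colorW-outside w (within y) (u∉P y)))

ProperOn : (Vtx → ℕ) → List Edge → Set
ProperOn col E = ∀ {x y} → (x , y) ∈ E → col x ≢ col y

module _ {col : Vtx → ℕ} where

  properOn-++ : ∀ {E F} → ProperOn col E → ProperOn col F → ProperOn col (E ++ F)
  properOn-++ {E} properE properF xy∈ with ∈-++⁻ E xy∈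
  ... | inj₁ xy∈E = properE xy∈E
  ... | inj₂ xy∈F = properF xy∈F

  properOn-concatMap : ∀ {A : Set} (f : A → List Edge) {xs} → (∀ x → x ∈ xs → ProperOn col (f x)) →
                       ProperOn col (concatMap f xs)
  properOn-concatMap f {xs} proper xy∈ with find (∈-concatMap⁻ f {xs = xs} xy∈)
  ... | x , x∈xs , xy∈fx = proper x x∈xs xy∈fx

-- Suspended paths, pendant vertices and paths

attached≢ : ∀ (a j : ℕ) h → a ∷ j ∷ h ≢ h
attached≢ a j h eq = m≢1+n+m (length h) (cong length (sym eq))

suspendedPath : Vtx → ℕ → List Edge
suspendedPath h j = (h , vC h j) ∷ (vC h j , vD h j) ∷ []

module _ (h : Vtx) (m : ℕ) where

  ∈-suspendedPaths⁻ : ∀ {e} → e ∈ suspendedPaths h m →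
                      ∃ λ j → j < m × (e ≡ (h , vC h j) ⊎ e ≡ (vC h j , vD h j))
  ∈-suspendedPaths⁻ e∈ with find (∈-concatMap⁻ (suspendedPath h) {xs = upTo m} e∈)
  ... | j , j∈ , here refl         = j , ∈-upTo⁻ j∈ , inj₁ refl
  ... | j , j∈ , there (here refl) = j , ∈-upTo⁻ j∈ , inj₂ refl

  legEdge∈suspendedPaths : ∀ {j} → j < m → (vC h j , vD h j) ∈ suspendedPaths h m
  legEdge∈suspendedPaths j<m = ∈-concatMap⁺ (suspendedPath h) (lose (∈-upTo⁺ j<m) (there (here refl)))

  within-suspendedPaths : ∀ {P} → T (P h) → (∀ j → T (P (vC h j))) → (∀ j → T (P (vD h j))) →
                          Within P (suspendedPaths h m)
  within-suspendedPaths Ph PC PD =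
    concat⁺ (map⁺ (applyUpTo⁺₂ id m (λ j → (Ph , PC j) ∷ (PC j , PD j) ∷ [])))

  module _ (w : Edge → Bool) where

    colorW-suspendedPaths-hub : colorW (suspendedPaths h m) w h ≡ sumOver (upTo m) (λ j → bit (w (h , vC h j)))
    colorW-suspendedPaths-hub = trans (colorW-concatMap w (suspendedPath h) (upTo m)) (sumOver-cong (upTo m) at-hub)
      where
      at-hub : ∀ j → j ∈ upTo m → colorW (suspendedPath h j) w h ≡ bit (w (h , vC h j))
      at-hub j _ = trans (cong₂ _+_ (incidentWeight-source w {h})
                                    (cong (_+ 0) (incidentWeight-≢ w {h} (attached≢ 6 j h ∘ sym) (attached≢ 7 j h ∘ sym))))
                         (+-identityʳ _)

    colorW-suspendedPaths-vC : ∀ {j} → j < m →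
      colorW (suspendedPaths h m) w (vC h j) ≡ bit (w (h , vC h j)) + bit (w (vC h j , vD h j))
    colorW-suspendedPaths-vC {j} j<m =
      trans (colorW-concatMap w (suspendedPath h) (upTo m))
            (trans (sumOver-single (upTo⁺ m) (∈-upTo⁺ j<m) elsewhere)
                   (cong₂ _+_ (incidentWeight-target w {vC h j}) (trans (+-identityʳ _) (incidentWeight-source w {vC h j}))))
      where
      elsewhere : ∀ j′ → j′ ∈ upTo m → j′ ≢ j → colorW (suspendedPath h j′) w (vC h j) ≡ 0
      elsewhere j′ _ j′≢j = cong₂ _+_ (incidentWeight-≢ w {vC h j} (attached≢ 6 j h) (λ { refl → j′≢j refl }))
                                      (cong (_+ 0) (incidentWeight-≢ w {vC h j} (λ { refl → j′≢j refl }) (λ ())))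

    colorW-suspendedPaths-vD : ∀ {j} → j < m → colorW (suspendedPaths h m) w (vD h j) ≡ bit (w (vC h j , vD h j))
    colorW-suspendedPaths-vD {j} j<m =
      trans (colorW-concatMap w (suspendedPath h) (upTo m))
            (trans (sumOver-single (upTo⁺ m) (∈-upTo⁺ j<m) elsewhere)
                   (cong₂ _+_ (incidentWeight-≢ w {vD h j} (attached≢ 7 j h) (λ ())) (trans (+-identityʳ _) (incidentWeight-target w {vD h j}))))
      where
      elsewhere : ∀ j′ → j′ ∈ upTo m → j′ ≢ j → colorW (suspendedPath h j′) w (vD h j) ≡ 0
      elsewhere j′ _ j′≢j = cong₂ _+_ (incidentWeight-≢ w {vD h j} (attached≢ 7 j h) (λ ()))
                                      (cong (_+ 0) (incidentWeight-≢ w {vD h j} (λ ()) (λ { refl → j′≢j refl })))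

    colorW-suspendedPaths-≢ : ∀ {u} → u ≢ h → (∀ j → u ≢ vC h j) → (∀ j → u ≢ vD h j) →
                              colorW (suspendedPaths h m) w u ≡ 0
    colorW-suspendedPaths-≢ {u} u≢h u≢C u≢D = colorW-≡0 w (suspendedPaths h m) untouched
      where
      untouched : ∀ {e} → e ∈ suspendedPaths h m → incidentWeight w u e ≡ 0
      untouched e∈ with ∈-suspendedPaths⁻ e∈
      ... | j , _ , inj₁ refl = incidentWeight-≢ w u≢h (u≢C j)
      ... | j , _ , inj₂ refl = incidentWeight-≢ w (u≢C j) (u≢D j)

module _ (h : Vtx) (m : ℕ) where

  ∈-pendants⁻ : ∀ {e} → e ∈ pendants h m → ∃ λ j → j < m × e ≡ (h , vPend h j)
  ∈-pendants⁻ e∈ with ∈-map⁻ (λ j → (h , vPend h j)) e∈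
  ... | j , j∈ , refl = j , ∈-upTo⁻ j∈ , refl

  within-pendants : ∀ {P} → T (P h) → (∀ j → T (P (vPend h j))) → Within P (pendants h m)
  within-pendants Ph Pp = map⁺ (applyUpTo⁺₂ id m (λ j → Ph , Pp j))

  module _ (w : Edge → Bool) where

    colorW-pendants-hub : colorW (pendants h m) w h ≡ sumOver (upTo m) (λ j → bit (w (h , vPend h j)))
    colorW-pendants-hub = trans (colorW-map w _ (upTo m)) (sumOver-cong (upTo m) (λ j _ → incidentWeight-source w {h}))

    colorW-pendants-leaf : ∀ {j} → j < m → colorW (pendants h m) w (vPend h j) ≡ bit (w (h , vPend h j))
    colorW-pendants-leaf {j} j<m =
      trans (colorW-map w _ (upTo m)) (trans (sumOver-single (upTo⁺ m) (∈-upTo⁺ j<m) elsewhere) (incidentWeight-target w {vPend h j}))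
      where
      elsewhere : ∀ j′ → j′ ∈ upTo m → j′ ≢ j → incidentWeight w (vPend h j) (h , vPend h j′) ≡ 0
      elsewhere j′ _ j′≢j = incidentWeight-≢ w {vPend h j} (attached≢ 5 j h) (λ { refl → j′≢j refl })

    colorW-pendants-≢ : ∀ {u} → u ≢ h → (∀ j → u ≢ vPend h j) → colorW (pendants h m) w u ≡ 0
    colorW-pendants-≢ {u} u≢h u≢p = colorW-≡0 w (pendants h m) untouched
      where
      untouched : ∀ {e} → e ∈ pendants h m → incidentWeight w u e ≡ 0
      untouched e∈ with ∈-pendants⁻ e∈
      ... | j , _ , refl = incidentWeight-≢ w u≢h (u≢p j)

startNeighbour : List Vtx → Vtx → Vtx
startNeighbour []      e = e
startNeighbour (x ∷ _) e = x

endNeighbour : Vtx → List Vtx → Vtx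
endNeighbour s []       = s
endNeighbour s (x ∷ xs) = endNeighbour x xs

startEdge∈pathEdges : ∀ s xs e → (s , startNeighbour xs e) ∈ pathEdges s xs e
startEdge∈pathEdges s []      e = here refl
startEdge∈pathEdges s (x ∷ _) e = here refl

∈-pathEdges⁻ : ∀ {x y} s xs e → (x , y) ∈ pathEdges s xs e → y ≡ e ⊎ y ∈ xs
∈-pathEdges⁻ s []       e (here refl)  = inj₁ refl
∈-pathEdges⁻ s (x ∷ xs) e (here refl)  = inj₂ (here refl)
∈-pathEdges⁻ s (x ∷ xs) e (there xy∈) = map₂ there (∈-pathEdges⁻ x xs e xy∈)

within-pathEdges : ∀ {P} s xs e → T (P s) → All (T ∘ P) xs → T (P e) → Within P (pathEdges s xs e)
within-pathEdges s []       e Ps []         Pe = (Ps , Pe) ∷ []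
within-pathEdges s (x ∷ xs) e Ps (Px ∷ Pxs) Pe = (Ps , Px) ∷ within-pathEdges x xs e Px Pxs Pe

module _ (w : Edge → Bool) where

  colorW-pathEdges-≢ : ∀ {u} s xs e → u ≢ s → All (u ≢_) xs → u ≢ e → colorW (pathEdges s xs e) w u ≡ 0
  colorW-pathEdges-≢ s []       e u≢s []            u≢e = cong (_+ 0) (incidentWeight-≢ w u≢s u≢e)
  colorW-pathEdges-≢ s (x ∷ xs) e u≢s (u≢x ∷ u≢xs) u≢e =
    cong₂ _+_ (incidentWeight-≢ w u≢s u≢x) (colorW-pathEdges-≢ x xs e u≢x u≢xs u≢e)

  colorW-pathEdges-start : ∀ s xs e → All (s ≢_) xs → s ≢ e →
                           colorW (pathEdges s xs e) w s ≡ bit (w (s , startNeighbour xs e))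
  colorW-pathEdges-start s []       e []           s≢e = trans (cong (_+ 0) (incidentWeight-source w {s})) (+-identityʳ _)
  colorW-pathEdges-start s (x ∷ xs) e (s≢x ∷ s≢xs) s≢e =
    trans (cong₂ _+_ (incidentWeight-source w {s}) (colorW-pathEdges-≢ x xs e s≢x s≢xs s≢e)) (+-identityʳ _)

  colorW-pathEdges-end : ∀ s xs e → e ≢ s → All (e ≢_) xs →
                         colorW (pathEdges s xs e) w e ≡ bit (w (endNeighbour s xs , e))
  colorW-pathEdges-end s []       e e≢s []           = trans (cong (_+ 0) (incidentWeight-target w {e})) (+-identityʳ _)
  colorW-pathEdges-end s (x ∷ xs) e e≢s (e≢x ∷ e≢xs) =
    trans (cong (_+ colorW (pathEdges x xs e) w e) (incidentWeight-≢ w e≢s e≢x)) (colorW-pathEdges-end x xs e e≢x e≢xs)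

bit+≢suc : ∀ b {k c} → c ≡ bit b + k → c ≢ suc k → b ≡ false × c ≡ k
bit+≢suc true  eq c≢1+k = ⊥-elim (c≢1+k eq)
bit+≢suc false eq _     = refl , eq

module _ (col : Vtx → ℕ) where

  pathEdges-ascending-proper :
    ∀ {s e} f m k → col s ≢ k → (∀ i → i < m → col (f i) ≡ k + i) → col e ≡ k + m →
    ∀ {x y} → (x , y) ∈ pathEdges s (applyUpTo f m) e → col x ≢ col y
  pathEdges-ascending-proper f zero    k s≢k _   e≡ (here refl) eq = s≢k (trans eq (trans e≡ (+-identityʳ k)))
  pathEdges-ascending-proper f (suc m) k s≢k f≡ e≡ (here refl) eq = s≢k (trans eq (trans (f≡ 0 z<s) (+-identityʳ k)))
  pathEdges-ascending-proper f (suc m) k s≢k f≡ e≡ (there xy∈) =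
    pathEdges-ascending-proper (f ∘ suc) m (suc k)
      (λ eq → 1+n≢n (sym (trans (sym (trans (f≡ 0 z<s) (+-identityʳ k))) eq)))
      (λ i i<m → trans (f≡ (suc i) (s<s i<m)) (+-suc k i))
      (trans e≡ (+-suc k m))
      xy∈

  module _ (w : Edge → Bool) where

    -- Induction from the end e: the vertex after x₁ = f 0 has colour k + 1 and weight 0 towards
    -- x₁, so x₁ has colour w(s, x₁) + k ≢ k + 1, which forces w(s, x₁) = 0.
    pathEdges-forced :
      ∀ {s e} f m k → let xs = applyUpTo f m ; P = pathEdges s xs e in
      All (s ≢_) xs → All (e ≢_) xs → Unique xs →
      (∀ {x y} → (x , y) ∈ P → col x ≢ col y) →
      (∀ i → i < m → col (f i) ≡ colorW P w (f i) + (k + i)) →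
      col e ≡ k + m → w (endNeighbour s xs , e) ≡ false →
      w (s , startNeighbour xs e) ≡ false × col (startNeighbour xs e) ≡ k
    pathEdges-forced f zero k _ _ _ _ _ e≡ w≡false = w≡false , trans e≡ (+-identityʳ k)
    pathEdges-forced {s} {e} f (suc m) k (s≢f0 ∷ s≢xs) (e≢f0 ∷ e≢xs) (f0∉xs ∷ unique) proper col-f e≡ w≡false =
      forced
      where
      xs  = applyUpTo (f ∘ suc) m
      P′  = pathEdges (f 0) xs e
      f₁  = startNeighbour xs e

      interior : ∀ i → i < m → col (f (suc i)) ≡ colorW P′ w (f (suc i)) + (suc k + i)
      interior i i<m = trans (col-f (suc i) (s<s i<m))
        (cong₂ _+_ (cong (_+ colorW P′ w (f (suc i))) (incidentWeight-≢ w (λ eq → All.lookup s≢xs fi∈ (sym eq))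
                                                                           (λ eq → All.lookup f0∉xs fi∈ (sym eq))))
                   (+-suc k i))
        where fi∈ = ∈-applyUpTo⁺ (f ∘ suc) i<m

      next : w (f 0 , f₁) ≡ false × col f₁ ≡ suc k
      next = pathEdges-forced (f ∘ suc) m (suc k) f0∉xs e≢xs unique (proper ∘ there) interior
                              (trans e≡ (+-suc k m)) w≡false

      col-f0 : col (f 0) ≡ bit (w (s , f 0)) + k
      col-f0 = begin
        col (f 0)                                         ≡⟨ col-f 0 z<s ⟩
        colorW ((s , f 0) ∷ P′) w (f 0) + (k + 0)         ≡⟨ cong (λ a → a + colorW P′ w (f 0) + (k + 0)) (incidentWeight-target w {f 0}) ⟩
        bit (w (s , f 0)) + colorW P′ w (f 0) + (k + 0)   ≡⟨ cong₂ (λ a b → bit (w (s , f 0)) + a + b) at-f0 (+-identityʳ k) ⟩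
        bit (w (s , f 0)) + 0 + k                         ≡⟨ cong (_+ k) (+-identityʳ _) ⟩
        bit (w (s , f 0)) + k                             ∎
        where
        open ≡-Reasoning
        at-f0 : colorW P′ w (f 0) ≡ 0
        at-f0 = trans (colorW-pathEdges-start w (f 0) xs e f0∉xs (e≢f0 ∘ sym)) (cong bit (proj₁ next))

      forced : w (s , f 0) ≡ false × col (f 0) ≡ k
      forced = bit+≢suc (w (s , f 0)) col-f0
                 (λ eq → proper (there (startEdge∈pathEdges (f 0) xs e)) (trans eq (sym (proj₂ next))))

vX-injective : ∀ {n} {v v′ : Fin n} {k k′ i i′} → vX v k i ≡ vX v′ k′ i′ → i ≡ i′
vX-injective eq = ∷-injectiveˡ (cong (drop 3) eq)

vG-injective : ∀ {n} {u v : Fin n} → vG u ≡ vG v → u ≡ v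
vG-injective eq = toℕ-injective (∷-injectiveˡ (cong (drop 1) eq))

data Leg (h : Vtx) : Vtx → Set where
  c-leg : ∀ j → Leg h (vC h j)
  d-leg : ∀ j → Leg h (vD h j)

-- The block of H containing a vertex; only z and the vertices of G lie in several blocks.
data Owner : Set where
  central    : Owner
  original   : ℕ → Owner
  gadgetPart : ℕ → Owner
  pathPart   : ℕ → ℕ → Owner
  vertexPart : ℕ → Owner
  unnamed    : Owner

attachmentOwner : Owner → Owner
attachmentOwner (original a) = vertexPart a
attachmentOwner o            = o

owner : Vtx → Owner
owner (0 ∷ a ∷ [])         = original a
owner (1 ∷ [])             = central
owner (2 ∷ i ∷ [])         = gadgetPart i
owner (3 ∷ i ∷ [])         = gadgetPart i
owner (4 ∷ a ∷ k ∷ _ ∷ []) = pathPart a k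
owner (5 ∷ _ ∷ h)          = attachmentOwner (owner h)
owner (6 ∷ _ ∷ h)          = attachmentOwner (owner h)
owner (7 ∷ _ ∷ h)          = attachmentOwner (owner h)
owner _                    = unnamed

inGraph : Owner → Bool
inGraph (original _) = true
inGraph _            = false

inGadget : ℕ → Owner → Bool
inGadget i central         = true
inGadget i (gadgetPart i′) = i′ ≡ᵇ i
inGadget i _               = false

inXPath : ℕ → ℕ → Owner → Bool
inXPath a k central          = true
inXPath a k (original a′)    = a′ ≡ᵇ a
inXPath a k (pathPart a′ k′) = (a′ ≡ᵇ a) ∧ (k′ ≡ᵇ k)
inXPath a k _                = false

inVertexGadget : ℕ → Owner → Bool
inVertexGadget a (original a′)   = a′ ≡ᵇ a
inVertexGadget a (vertexPart a′) = a′ ≡ᵇ a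
inVertexGadget a _               = false

¬T-owner : ∀ (P : Owner → Bool) u {o} → owner u ≡ o → ¬ T (P o) → ¬ T (P (owner u))
¬T-owner P u owned = subst (λ o → ¬ T (P o)) (sym owned)

module _ {n : ℕ} (G : Graph n) (L : ListAssignment n) where
  open Construction G L hiding (edgesH)
  open Defs using (edgesH)

  gadgets xPaths vertexGadgets : List Edge
  gadgets       = concatMap gadget (range 1 N)
  xPaths        = concatMap (λ v → concatMap (xPath v) (missing v)) (allFin n)
  vertexGadgets = concatMap vertexGadget (allFin n)

  interior : Fin n → ℕ → List Vtx
  interior v k = applyUpTo (vX v k ∘ suc) (N ∸ k)

  interior-unique : ∀ v k → Unique (interior v k)
  interior-unique v k = applyUpTo⁺₁ (vX v k ∘ suc) (N ∸ k) (λ i<j _ eq → <⇒≢ i<j (suc-injective (vX-injective eq)))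

  spine spineLegs : Fin n → ℕ → List Edge
  spine v k     = pathEdges (vG v) (interior v k) vZ
  spineLegs v k = concatMap (λ i → suspendedPaths (vX v k i) (k + i ∸ 1)) (range 1 (N ∸ k))

  xPath≡spine++spineLegs : ∀ v k → xPath v k ≡ spine v k ++ spineLegs v k
  xPath≡spine++spineLegs v k = cong (λ xs → pathEdges (vG v) xs vZ ++ spineLegs v k)
    (trans (cong (map (vX v k)) (map-applyUpTo id suc (N ∸ k))) (map-applyUpTo suc (vX v k) (N ∸ k)))

  missing-unique : ∀ v → Unique (missing v)
  missing-unique v = Unique.filter⁺ (λ k → T? (not (elemᵇ k (L v)))) (range-unique 2 (t + n ∸ 1))

  ∈-missing⁻ : ∀ {v k} → k ∈ missing v → (2 ≤ k × k ≤ t + n ∸ 1) × k ∉ L v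
  ∈-missing⁻ {v} {k} k∈ with ∈-filter⁻ (λ k → T? (not (elemᵇ k (L v)))) {xs = range 2 (t + n ∸ 1)} k∈
  ... | k∈range , k∉ = ∈-range⁻ k∈range , T-not⇒¬T k∉ ∘ ∈⇒elemᵇ

  ∈-missing⁺ : ∀ {v k} → 2 ≤ k → k ≤ t + n ∸ 1 → k ∉ L v → k ∈ missing v
  ∈-missing⁺ {v} {k} 2≤k k≤ k∉ =
    ∈-filter⁺ (λ k → T? (not (elemᵇ k (L v)))) (∈-range⁺ 2≤k k≤) (¬T⇒T-not (k∉ ∘ elemᵇ⇒∈ k (L v)))

  length-missing≤ : ∀ v → length (missing v) ≤ t + n ∸ 1 ∸ 1
  length-missing≤ v = ≤-trans (length-filter (λ k → T? (not (elemᵇ k (L v)))) (range 2 (t + n ∸ 1)))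
                              (≤-reflexive (length-range 2 (t + n ∸ 1)))

  private
    edgeOf : Fin n → Fin n → List Edge
    edgeOf u v = if adj G u v ∧ (toℕ u <ᵇ toℕ v) then (vG u , vG v) ∷ [] else []

  within-edgesG : Within (inGraph ∘ owner) edgesG
  within-edgesG = concat⁺ (map⁺ (All.universal (λ u → concat⁺ (map⁺ (All.universal (within-edgeOf u) (allFin n)))) (allFin n)))
    where
    within-edgeOf : ∀ u v → Within (inGraph ∘ owner) (edgeOf u v)
    within-edgeOf u v with adj G u v ∧ (toℕ u <ᵇ toℕ v)
    ... | true  = _ ∷ []
    ... | false = []

  within-gadget : ∀ i → Within (inGadget i ∘ owner) (gadget i)
  within-gadget i = (_ , ≡ᵇ-refl i) ∷ (_ , ≡ᵇ-refl i) ∷ (≡ᵇ-refl i , ≡ᵇ-refl i) ∷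
    ++⁺ (within-suspendedPaths (vA i) (N + i ∸ 1) (≡ᵇ-refl i) (λ _ → ≡ᵇ-refl i) (λ _ → ≡ᵇ-refl i))
        (within-suspendedPaths (vB i) (N + i ∸ 1) (≡ᵇ-refl i) (λ _ → ≡ᵇ-refl i) (λ _ → ≡ᵇ-refl i))

  within-xPath : ∀ v k → Within (inXPath (toℕ v) k ∘ owner) (xPath v k)
  within-xPath v k = ++⁺
    (within-pathEdges (vG v) (map (vX v k) (range 1 (N ∸ k))) vZ a≡a (map⁺ (All.universal (λ _ → ak≡ak) _)) _)
    (concat⁺ (map⁺ (All.universal (λ i → within-suspendedPaths (vX v k i) (k + i ∸ 1) ak≡ak (λ _ → ak≡ak) (λ _ → ak≡ak))
                                  (range 1 (N ∸ k)))))
    where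
    a≡a = ≡ᵇ-refl (toℕ v)
    ak≡ak : T ((toℕ v ≡ᵇ toℕ v) ∧ (k ≡ᵇ k))
    ak≡ak = T-∧ .Equivalence.from (a≡a , ≡ᵇ-refl k)

  within-vertexGadget : ∀ v → Within (inVertexGadget (toℕ v) ∘ owner) (vertexGadget v)
  within-vertexGadget v = ++⁺ (within-pendants (vG v) (t ∸ 2) a≡a (λ _ → a≡a))
                              (within-suspendedPaths (vG v) 2 a≡a (λ _ → a≡a) (λ _ → a≡a))
    where a≡a = ≡ᵇ-refl (toℕ v)

  edgesG⊆edgesH : edgesG ⊆ edgesH G L
  edgesG⊆edgesH = ∈-++⁺ˡ

  gadget⊆edgesH : ∀ {i} → i ∈ range 1 N → gadget i ⊆ edgesH G L
  gadget⊆edgesH i∈ e∈ = ∈-++⁺ʳ edgesG (∈-++⁺ˡ (∈-concatMap⁺ gadget (lose i∈ e∈)))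

  xPath⊆edgesH : ∀ {v k} → k ∈ missing v → xPath v k ⊆ edgesH G L
  xPath⊆edgesH {v} k∈ e∈ = ∈-++⁺ʳ edgesG (∈-++⁺ʳ gadgets (∈-++⁺ˡ
    (∈-concatMap⁺ (λ v → concatMap (xPath v) (missing v)) (lose (∈-allFin v) (∈-concatMap⁺ (xPath v) (lose k∈ e∈))))))

  vertexGadget⊆edgesH : ∀ {v} → vertexGadget v ⊆ edgesH G L
  vertexGadget⊆edgesH {v} e∈ = ∈-++⁺ʳ edgesG (∈-++⁺ʳ gadgets (∈-++⁺ʳ xPaths (∈-concatMap⁺ vertexGadget (lose (∈-allFin v) e∈))))

  spine⊆xPath : ∀ {v k} → spine v k ⊆ xPath v k
  spine⊆xPath {v} {k} e∈ = subst (_ ∈_) (sym (xPath≡spine++spineLegs v k)) (∈-++⁺ˡ e∈)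

  spineLegs⊆xPath : ∀ {v k} → spineLegs v k ⊆ xPath v k
  spineLegs⊆xPath {v} {k} e∈ = subst (_ ∈_) (sym (xPath≡spine++spineLegs v k)) (∈-++⁺ʳ (spine v k) e∈)

  adjacent⇒∈edgesH : ∀ {u v} → adj G u v ≡ true → toℕ u < toℕ v → (vG u , vG v) ∈ edgesH G L
  adjacent⇒∈edgesH {u} {v} uv∈G u<v = edgesG⊆edgesH
    (∈-concatMap⁺ (λ u → concatMap (edgeOf u) (allFin n)) (lose (∈-allFin u) (∈-concatMap⁺ (edgeOf u) (lose (∈-allFin v) listed))))
    where
    listed : (vG u , vG v) ∈ edgeOf u v
    listed rewrite uv∈G | T-≡ .Equivalence.to (<⇒<ᵇ u<v) = here refl

  ∈-edgesG⁻ : ∀ {x y} → (x , y) ∈ edgesG → ∃ λ u → ∃ λ v → adj G u v ≡ true × x ≡ vG u × y ≡ vG v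
  ∈-edgesG⁻ xy∈ with find (∈-concatMap⁻ (λ u → concatMap (edgeOf u) (allFin n)) {xs = allFin n} xy∈)
  ... | u , _ , xy∈u with find (∈-concatMap⁻ (edgeOf u) {xs = allFin n} xy∈u)
  ... | v , _ , xy∈uv with adj G u v in uv∈G | toℕ u <ᵇ toℕ v
  ...   | true | true = u , v , uv∈G , listed xy∈uv
    where listed : ∀ {x y} → (x , y) ∈ (vG u , vG v) ∷ [] → x ≡ vG u × y ≡ vG v
          listed (here refl) = refl , refl

  data Hub : Vtx → ℕ → Set where
    a-hub : ∀ {i} → i ∈ range 1 N → Hub (vA i) (N + i ∸ 1)
    b-hub : ∀ {i} → i ∈ range 1 N → Hub (vB i) (N + i ∸ 1)
    x-hub : ∀ {v k i} → k ∈ missing v → i ∈ range 1 (N ∸ k) → Hub (vX v k i) (k + i ∸ 1)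
    g-hub : ∀ (v : Fin n) → Hub (vG v) 2

  suspendedPaths⊆edgesH : ∀ {h m} → Hub h m → suspendedPaths h m ⊆ edgesH G L
  suspendedPaths⊆edgesH (a-hub i∈)    e∈ = gadget⊆edgesH i∈ (there (there (there (∈-++⁺ˡ e∈))))
  suspendedPaths⊆edgesH (b-hub i∈)    e∈ = gadget⊆edgesH i∈ (there (there (there (∈-++⁺ʳ (suspendedPaths (vA _) (N + _ ∸ 1)) e∈))))
  suspendedPaths⊆edgesH (x-hub {v} {k} k∈ i∈) e∈ =
    xPath⊆edgesH {v} {k} k∈ (spineLegs⊆xPath {v} {k} (∈-concatMap⁺ (λ i → suspendedPaths (vX v k i) (k + i ∸ 1)) (lose i∈ e∈)))
  suspendedPaths⊆edgesH (g-hub v)     e∈ = vertexGadget⊆edgesH (∈-++⁺ʳ (pendants (vG v) (t ∸ 2)) e∈)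

  module Colors (w : Edge → Bool) where

    colorH : Vtx → ℕ
    colorH = colorW (edgesH G L) w

    colorH-blocks : ∀ u → colorH u ≡ colorW edgesG w u + (colorW gadgets w u + (colorW xPaths w u + colorW vertexGadgets w u))
    colorH-blocks u =
      trans (colorW-++ w {u} edgesG _) (cong (colorW edgesG w u +_)
      (trans (colorW-++ w {u} gadgets _) (cong (colorW gadgets w u +_) (colorW-++ w {u} xPaths vertexGadgets))))

    edgesG-outside : ∀ {u} → ¬ T (inGraph (owner u)) → colorW edgesG w u ≡ 0
    edgesG-outside {u} = colorW-outside w {u} within-edgesG

    gadgets-outside : ∀ {u} → (∀ i → ¬ T (inGadget i (owner u))) → colorW gadgets w u ≡ 0
    gadgets-outside {u} = colorW-concatMap-outside w {u} gadget (range 1 N) within-gadget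

    xPaths-outside : ∀ {u} → (∀ a k → ¬ T (inXPath a k (owner u))) → colorW xPaths w u ≡ 0
    xPaths-outside {u} u∉ = trans (colorW-concatMap w {u} _ (allFin n)) (sumOver-zero (allFin n) λ v _ →
      colorW-concatMap-outside w {u} (xPath v) (missing v) (within-xPath v) (u∉ (toℕ v)))

    vertexGadgets-outside : ∀ {u} → (∀ a → ¬ T (inVertexGadget a (owner u))) → colorW vertexGadgets w u ≡ 0
    vertexGadgets-outside {u} u∉ = colorW-concatMap-outside w {u} vertexGadget (allFin n) within-vertexGadget (u∉ ∘ toℕ)

    colorH-gadgetPart : ∀ {i u} → i ∈ range 1 N → owner u ≡ gadgetPart i → colorH u ≡ colorW (gadget i) w u
    colorH-gadgetPart {i} {u} i∈ owned = trans (colorH-blocks u) (trans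
      (cong₂ _+_ (edgesG-outside (¬T-owner inGraph u owned (λ ())))
        (cong₂ _+_ (colorW-concatMap-single w {u} gadget (range-unique 1 N) i∈ other-gadget)
          (cong₂ _+_ (xPaths-outside (λ a k → ¬T-owner (inXPath a k) u owned (λ ())))
                     (vertexGadgets-outside (λ a → ¬T-owner (inVertexGadget a) u owned (λ ()))))))
      (+-identityʳ _))
      where
      other-gadget : ∀ i′ → i′ ∈ range 1 N → i′ ≢ i → colorW (gadget i′) w u ≡ 0
      other-gadget i′ _ i′≢i = colorW-outside w {u} (within-gadget i′) (¬T-owner (inGadget i′) u owned (λ i≡i′ → i′≢i (sym (≡ᵇ⇒≡ i i′ i≡i′))))

    colorH-pathPart : ∀ {v k u} → k ∈ missing v → owner u ≡ pathPart (toℕ v) k → colorH u ≡ colorW (xPath v k) w u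
    colorH-pathPart {v} {k} {u} k∈ owned = trans (colorH-blocks u) (trans
      (cong₂ _+_ (edgesG-outside (¬T-owner inGraph u owned (λ ())))
        (cong₂ _+_ (gadgets-outside (λ i → ¬T-owner (inGadget i) u owned (λ ())))
          (cong₂ _+_ (trans (colorW-concatMap-single w {u} (λ v → concatMap (xPath v) (missing v)) (Unique.allFin⁺ n) (∈-allFin v) other-vertex)
                            (colorW-concatMap-single w {u} (xPath v) (missing-unique v) k∈ other-colour))
                     (vertexGadgets-outside (λ a → ¬T-owner (inVertexGadget a) u owned (λ ()))))))
      (+-identityʳ _))
      where
      other-vertex : ∀ v′ → v′ ∈ allFin n → v′ ≢ v → colorW (concatMap (xPath v′) (missing v′)) w u ≡ 0
      other-vertex v′ _ v′≢v = colorW-concatMap-outside w {u} (xPath v′) (missing v′) (within-xPath v′)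
        (λ k′ → ¬T-owner (inXPath (toℕ v′) k′) u owned
                  (λ t → v′≢v (toℕ-injective (sym (≡ᵇ⇒≡ (toℕ v) (toℕ v′) (proj₁ (T-∧ .Equivalence.to t)))))))
      other-colour : ∀ k′ → k′ ∈ missing v → k′ ≢ k → colorW (xPath v k′) w u ≡ 0
      other-colour k′ _ k′≢k = colorW-outside w {u} (within-xPath v k′) (¬T-owner (inXPath (toℕ v) k′) u owned
        (λ t → k′≢k (sym (≡ᵇ⇒≡ k k′ (proj₂ (T-∧ .Equivalence.to t))))))

    colorH-vertexPart : ∀ {v u} → owner u ≡ vertexPart (toℕ v) → colorH u ≡ colorW (vertexGadget v) w u
    colorH-vertexPart {v} {u} owned = trans (colorH-blocks u) (trans
      (cong₂ _+_ (edgesG-outside (¬T-owner inGraph u owned (λ ())))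
        (cong₂ _+_ (gadgets-outside (λ i → ¬T-owner (inGadget i) u owned (λ ())))
          (cong₂ _+_ (xPaths-outside (λ a k → ¬T-owner (inXPath a k) u owned (λ ())))
                     (colorW-concatMap-single w {u} vertexGadget (Unique.allFin⁺ n) (∈-allFin v) other-vertex))))
      refl)
      where
      other-vertex : ∀ v′ → v′ ∈ allFin n → v′ ≢ v → colorW (vertexGadget v′) w u ≡ 0
      other-vertex v′ _ v′≢v = colorW-outside w {u} (within-vertexGadget v′) (¬T-owner (inVertexGadget (toℕ v′)) u owned
        (λ t → v′≢v (toℕ-injective (sym (≡ᵇ⇒≡ (toℕ v) (toℕ v′) t)))))

    module _ (i : ℕ) where
      private
        legsA legsB : List Edge
        legsA = suspendedPaths (vA i) (N + i ∸ 1)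
        legsB = suspendedPaths (vB i) (N + i ∸ 1)

        colorW-gadget : ∀ u → colorW (gadget i) w u ≡
          incidentWeight w u (vZ , vA i) + (incidentWeight w u (vZ , vB i) + (incidentWeight w u (vA i , vB i) +
          (colorW legsA w u + colorW legsB w u)))
        colorW-gadget u = cong (λ c → incidentWeight w u (vZ , vA i) + (incidentWeight w u (vZ , vB i) +
                                      (incidentWeight w u (vA i , vB i) + c))) (colorW-++ w {u} legsA legsB)

      colorW-gadget-vZ : colorW (gadget i) w vZ ≡ bit (w (vZ , vA i)) + bit (w (vZ , vB i))
      colorW-gadget-vZ = trans (colorW-gadget vZ)
        (cong₂ _+_ (incidentWeight-source w {vZ}) (trans (cong₂ _+_ (incidentWeight-source w {vZ})
          (cong₂ _+_ (incidentWeight-≢ w {vZ} {vA i} {vB i} (λ ()) (λ ()))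
            (cong₂ _+_ (colorW-suspendedPaths-≢ (vA i) (N + i ∸ 1) w {vZ} (λ ()) (λ _ ()) (λ _ ()))
                       (colorW-suspendedPaths-≢ (vB i) (N + i ∸ 1) w {vZ} (λ ()) (λ _ ()) (λ _ ())))))
          (+-identityʳ _)))

      colorW-gadget-vA : colorW (gadget i) w (vA i) ≡ bit (w (vZ , vA i)) + (bit (w (vA i , vB i)) + colorW legsA w (vA i))
      colorW-gadget-vA = trans (colorW-gadget (vA i))
        (cong₂ _+_ (incidentWeight-target w {vA i}) (cong₂ _+_ (incidentWeight-≢ w {vA i} {vZ} {vB i} (λ ()) (λ ()))
          (cong₂ _+_ (incidentWeight-source w {vA i})
            (trans (cong (colorW legsA w (vA i) +_) (colorW-suspendedPaths-≢ (vB i) (N + i ∸ 1) w {vA i} (λ ()) (λ _ ()) (λ _ ())))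
                   (+-identityʳ _)))))

      colorW-gadget-vB : colorW (gadget i) w (vB i) ≡ bit (w (vZ , vB i)) + (bit (w (vA i , vB i)) + colorW legsB w (vB i))
      colorW-gadget-vB = trans (colorW-gadget (vB i))
        (cong₂ _+_ (incidentWeight-≢ w {vB i} {vZ} {vA i} (λ ()) (λ ())) (cong₂ _+_ (incidentWeight-target w {vB i})
          (cong₂ _+_ (incidentWeight-target w {vB i})
            (cong (_+ colorW legsB w (vB i)) (colorW-suspendedPaths-≢ (vA i) (N + i ∸ 1) w {vB i} (λ ()) (λ _ ()) (λ _ ()))))))

      private
        colorW-gadget-legs : ∀ {u} → u ≢ vZ → u ≢ vA i → u ≢ vB i → colorW (gadget i) w u ≡ colorW legsA w u + colorW legsB w u
        colorW-gadget-legs {u} u≢z u≢a u≢b = trans (colorW-gadget u)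
          (cong₂ _+_ (incidentWeight-≢ w u≢z u≢a) (cong₂ _+_ (incidentWeight-≢ w u≢z u≢b) (cong₂ _+_ (incidentWeight-≢ w u≢a u≢b) refl)))

        only-legsA : ∀ {u} → u ≢ vZ → u ≢ vA i → u ≢ vB i → colorW legsB w u ≡ 0 → colorW (gadget i) w u ≡ colorW legsA w u
        only-legsA {u} u≢z u≢a u≢b B≡0 =
          trans (colorW-gadget-legs u≢z u≢a u≢b) (trans (cong (colorW legsA w u +_) B≡0) (+-identityʳ _))

        only-legsB : ∀ {u} → u ≢ vZ → u ≢ vA i → u ≢ vB i → colorW legsA w u ≡ 0 → colorW (gadget i) w u ≡ colorW legsB w u
        only-legsB {u} u≢z u≢a u≢b A≡0 = trans (colorW-gadget-legs u≢z u≢a u≢b) (cong (_+ colorW legsB w u) A≡0)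

      colorW-gadget-legA : ∀ {u} → Leg (vA i) u → colorW (gadget i) w u ≡ colorW legsA w u
      colorW-gadget-legA (c-leg j) = only-legsA (λ ()) (λ ()) (λ ()) (colorW-suspendedPaths-≢ (vB i) (N + i ∸ 1) w (λ ()) (λ _ ()) (λ _ ()))
      colorW-gadget-legA (d-leg j) = only-legsA (λ ()) (λ ()) (λ ()) (colorW-suspendedPaths-≢ (vB i) (N + i ∸ 1) w (λ ()) (λ _ ()) (λ _ ()))

      colorW-gadget-legB : ∀ {u} → Leg (vB i) u → colorW (gadget i) w u ≡ colorW legsB w u
      colorW-gadget-legB (c-leg j) = only-legsB (λ ()) (λ ()) (λ ()) (colorW-suspendedPaths-≢ (vA i) (N + i ∸ 1) w (λ ()) (λ _ ()) (λ _ ()))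
      colorW-gadget-legB (d-leg j) = only-legsB (λ ()) (λ ()) (λ ()) (colorW-suspendedPaths-≢ (vA i) (N + i ∸ 1) w (λ ()) (λ _ ()) (λ _ ()))

    module _ (v : Fin n) (k : ℕ) where
      private
        legsAt : ℕ → List Edge
        legsAt i = suspendedPaths (vX v k i) (k + i ∸ 1)

        colorW-xPath : ∀ u → colorW (xPath v k) w u ≡ colorW (spine v k) w u + colorW (spineLegs v k) w u
        colorW-xPath u = trans (cong (λ E → colorW E w u) (xPath≡spine++spineLegs v k)) (colorW-++ w {u} (spine v k) _)

        spineLegs-≢ : ∀ {u} → (∀ i → u ≢ vX v k i) → (∀ i j → u ≢ vC (vX v k i) j) → (∀ i j → u ≢ vD (vX v k i) j) →
                      colorW (spineLegs v k) w u ≡ 0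
        spineLegs-≢ {u} u≢x u≢c u≢d = trans (colorW-concatMap w {u} legsAt (range 1 (N ∸ k)))
          (sumOver-zero (range 1 (N ∸ k)) (λ i _ → colorW-suspendedPaths-≢ (vX v k i) (k + i ∸ 1) w (u≢x i) (u≢c i) (u≢d i)))

        spineLegs-single : ∀ {i u} → i ∈ range 1 (N ∸ k) → (∀ i′ → i′ ≢ i → colorW (legsAt i′) w u ≡ 0) →
                           colorW (spineLegs v k) w u ≡ colorW (legsAt i) w u
        spineLegs-single {i} {u} i∈ others = colorW-concatMap-single w {u} legsAt (range-unique 1 (N ∸ k)) i∈ (λ i′ _ → others i′)

        spine-≢ : ∀ {u} → u ≢ vG v → (∀ i → u ≢ vX v k i) → u ≢ vZ → colorW (spine v k) w u ≡ 0
        spine-≢ u≢g u≢x u≢z = colorW-pathEdges-≢ w (vG v) (interior v k) vZ u≢g (applyUpTo⁺₂ _ (N ∸ k) (u≢x ∘ suc)) u≢z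

      colorW-xPath-vZ : colorW (xPath v k) w vZ ≡ bit (w (endNeighbour (vG v) (interior v k) , vZ))
      colorW-xPath-vZ = trans (colorW-xPath vZ) (trans
        (cong₂ _+_ (colorW-pathEdges-end w (vG v) (interior v k) vZ (λ ()) (applyUpTo⁺₂ _ (N ∸ k) (λ _ ())))
                   (spineLegs-≢ (λ _ ()) (λ _ _ ()) (λ _ _ ())))
        (+-identityʳ _))

      colorW-xPath-vG : colorW (xPath v k) w (vG v) ≡ bit (w (vG v , startNeighbour (interior v k) vZ))
      colorW-xPath-vG = trans (colorW-xPath (vG v)) (trans
        (cong₂ _+_ (colorW-pathEdges-start w (vG v) (interior v k) vZ (applyUpTo⁺₂ _ (N ∸ k) (λ _ ())) (λ ()))
                   (spineLegs-≢ (λ _ ()) (λ _ _ ()) (λ _ _ ())))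
        (+-identityʳ _))

      colorW-xPath-vX : ∀ {j} → j < N ∸ k → let x = vX v k (suc j) in
                        colorW (xPath v k) w x ≡ colorW (spine v k) w x + colorW (suspendedPaths x (k + j)) w x
      colorW-xPath-vX {j} j< = trans (colorW-xPath x) (cong (colorW (spine v k) w x +_) (trans
        (spineLegs-single (∈-range⁺ (s≤s z≤n) j<) other-hub)
        (cong (λ m → colorW (suspendedPaths x (m ∸ 1)) w x) (+-suc k j))))
        where
        x = vX v k (suc j)
        other-hub : ∀ i′ → i′ ≢ suc j → colorW (legsAt i′) w x ≡ 0
        other-hub i′ i′≢ = colorW-suspendedPaths-≢ (vX v k i′) (k + i′ ∸ 1) w (λ eq → i′≢ (sym (vX-injective eq))) (λ _ ()) (λ _ ())

      colorW-xPath-leg : ∀ {i u} → i ∈ range 1 (N ∸ k) → Leg (vX v k i) u → colorW (xPath v k) w u ≡ colorW (legsAt i) w u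
      colorW-xPath-leg i∈ (c-leg j) = trans (colorW-xPath _) (cong₂ _+_ (spine-≢ (λ ()) (λ _ ()) (λ ()))
        (spineLegs-single i∈ λ i′ i′≢i → colorW-suspendedPaths-≢ (vX v k i′) (k + i′ ∸ 1) w (λ ())
                                            (λ _ eq → i′≢i (sym (vX-injective (cong (drop 2) eq)))) (λ _ ())))
      colorW-xPath-leg i∈ (d-leg j) = trans (colorW-xPath _) (cong₂ _+_ (spine-≢ (λ ()) (λ _ ()) (λ ()))
        (spineLegs-single i∈ λ i′ i′≢i → colorW-suspendedPaths-≢ (vX v k i′) (k + i′ ∸ 1) w (λ ()) (λ _ ())
                                            (λ _ eq → i′≢i (sym (vX-injective (cong (drop 2) eq))))))

    module _ (v : Fin n) where

      colorW-vertexGadget-pendant : ∀ {j} → j < t ∸ 2 → colorW (vertexGadget v) w (vPend (vG v) j) ≡ bit (w (vG v , vPend (vG v) j))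
      colorW-vertexGadget-pendant {j} j< = trans (colorW-++ w {vPend (vG v) j} (pendants (vG v) (t ∸ 2)) _)
        (trans (cong₂ _+_ (colorW-pendants-leaf (vG v) (t ∸ 2) w j<) (colorW-suspendedPaths-≢ (vG v) 2 w {vPend (vG v) j} (λ ()) (λ _ ()) (λ _ ())))
               (+-identityʳ _))

      colorW-vertexGadget-leg : ∀ {u} → Leg (vG v) u → colorW (vertexGadget v) w u ≡ colorW (suspendedPaths (vG v) 2) w u
      colorW-vertexGadget-leg (c-leg j) = trans (colorW-++ w (pendants (vG v) (t ∸ 2)) _)
        (cong (_+ colorW (suspendedPaths (vG v) 2) w (vC (vG v) j)) (colorW-pendants-≢ (vG v) (t ∸ 2) w (λ ()) (λ _ ())))
      colorW-vertexGadget-leg (d-leg j) = trans (colorW-++ w (pendants (vG v) (t ∸ 2)) _)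
        (cong (_+ colorW (suspendedPaths (vG v) 2) w (vD (vG v) j)) (colorW-pendants-≢ (vG v) (t ∸ 2) w (λ ()) (λ _ ())))

    private
      leg-owner : ∀ {h u} → Leg h u → owner u ≡ attachmentOwner (owner h)
      leg-owner (c-leg j) = refl
      leg-owner (d-leg j) = refl

    colorH-leg : ∀ {h m u} → Hub h m → Leg h u → colorH u ≡ colorW (suspendedPaths h m) w u
    colorH-leg (a-hub i∈)    leg = trans (colorH-gadgetPart i∈ (leg-owner leg)) (colorW-gadget-legA _ leg)
    colorH-leg (b-hub i∈)    leg = trans (colorH-gadgetPart i∈ (leg-owner leg)) (colorW-gadget-legB _ leg)
    colorH-leg (x-hub k∈ i∈) leg = trans (colorH-pathPart k∈ (leg-owner leg)) (colorW-xPath-leg _ _ i∈ leg)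
    colorH-leg (g-hub v)     leg = trans (colorH-vertexPart (leg-owner leg)) (colorW-vertexGadget-leg v leg)

    colorH-vC : ∀ {h m j} → Hub h m → j < m → colorH (vC h j) ≡ bit (w (h , vC h j)) + bit (w (vC h j , vD h j))
    colorH-vC {h} {m} {j} hub j<m = trans (colorH-leg hub (c-leg j)) (colorW-suspendedPaths-vC h m w j<m)

    colorH-vD : ∀ {h m j} → Hub h m → j < m → colorH (vD h j) ≡ bit (w (vC h j , vD h j))
    colorH-vD {h} {m} {j} hub j<m = trans (colorH-leg hub (d-leg j)) (colorW-suspendedPaths-vD h m w j<m)

    colorH-vA : ∀ {i} → i ∈ range 1 N →
      colorH (vA i) ≡ bit (w (vZ , vA i)) + (bit (w (vA i , vB i)) + colorW (suspendedPaths (vA i) (N + i ∸ 1)) w (vA i))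
    colorH-vA i∈ = trans (colorH-gadgetPart i∈ refl) (colorW-gadget-vA _)

    colorH-vB : ∀ {i} → i ∈ range 1 N →
      colorH (vB i) ≡ bit (w (vZ , vB i)) + (bit (w (vA i , vB i)) + colorW (suspendedPaths (vB i) (N + i ∸ 1)) w (vB i))
    colorH-vB i∈ = trans (colorH-gadgetPart i∈ refl) (colorW-gadget-vB _)

    colorH-vX : ∀ {v k j} → k ∈ missing v → j < N ∸ k → let x = vX v k (suc j) in
                colorH x ≡ colorW (spine v k) w x + colorW (suspendedPaths x (k + j)) w x
    colorH-vX {v} {k} k∈ j< = trans (colorH-pathPart k∈ refl) (colorW-xPath-vX v k j<)

    colorH-pendant : ∀ {v j} → j < t ∸ 2 → colorH (vPend (vG v) j) ≡ bit (w (vG v , vPend (vG v) j))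
    colorH-pendant {v} j< = trans (colorH-vertexPart refl) (colorW-vertexGadget-pendant v j<)

    colorH-vZ : colorH vZ ≡ sumOver (range 1 N) (λ i → bit (w (vZ , vA i)) + bit (w (vZ , vB i)))
                          + sumOver (allFin n) (λ v → sumOver (missing v) (λ k → bit (w (endNeighbour (vG v) (interior v k) , vZ))))
    colorH-vZ = trans (colorH-blocks vZ)
      (cong₂ _+_ (edgesG-outside (λ ()))
        (cong₂ _+_ (trans (colorW-concatMap w {vZ} gadget (range 1 N)) (sumOver-cong (range 1 N) (λ i _ → colorW-gadget-vZ i)))
          (trans (cong₂ _+_ (trans (colorW-concatMap w {vZ} _ (allFin n)) (sumOver-cong (allFin n) λ v _ →
                              trans (colorW-concatMap w {vZ} (xPath v) (missing v)) (sumOver-cong (missing v) λ k _ → colorW-xPath-vZ v k)))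
                            (vertexGadgets-outside (λ _ ())))
                 (+-identityʳ _))))

    colorH-vG : ∀ v → colorH (vG v) ≡ colorW edgesG w (vG v)
      + (sumOver (missing v) (λ k → bit (w (vG v , startNeighbour (interior v k) vZ)))
      + (colorW (pendants (vG v) (t ∸ 2)) w (vG v) + colorW (suspendedPaths (vG v) 2) w (vG v)))
    colorH-vG v = trans (colorH-blocks (vG v))
      (cong (colorW edgesG w (vG v) +_) (cong₂ _+_
        (gadgets-outside (λ _ ()))
        (cong₂ _+_
          (trans (colorW-concatMap-single w {vG v} (λ v → concatMap (xPath v) (missing v)) (Unique.allFin⁺ n) (∈-allFin v) other-paths)
                 (trans (colorW-concatMap w {vG v} (xPath v) (missing v)) (sumOver-cong (missing v) λ k _ → colorW-xPath-vG v k)))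
          (trans (colorW-concatMap-single w {vG v} vertexGadget (Unique.allFin⁺ n) (∈-allFin v) other-gadgets)
                 (colorW-++ w {vG v} (pendants (vG v) (t ∸ 2)) _)))))
      where
      other≢ : ∀ {v′} → v′ ≢ v → ¬ T (toℕ v ≡ᵇ toℕ v′)
      other≢ v′≢v t = v′≢v (toℕ-injective (sym (≡ᵇ⇒≡ _ _ t)))
      other-paths : ∀ v′ → v′ ∈ allFin n → v′ ≢ v → colorW (concatMap (xPath v′) (missing v′)) w (vG v) ≡ 0
      other-paths v′ _ v′≢v = colorW-concatMap-outside w {vG v} (xPath v′) (missing v′) (within-xPath v′) (λ _ → other≢ v′≢v)
      other-gadgets : ∀ v′ → v′ ∈ allFin n → v′ ≢ v → colorW (vertexGadget v′) w (vG v) ≡ 0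
      other-gadgets v′ _ v′≢v = colorW-outside w {vG v} (within-vertexGadget v′) (other≢ v′≢v)

  module _ (w : Edge → Bool) where
    private
      single-edge≤1 : ∀ {x y u : Vtx} → colorW ((x , y) ∷ []) w u ≤ 1
      single-edge≤1 {x} {y} {u} with isYes (u ≟V x) ∨ isYes (u ≟V y)
      ... | true  = ≤-trans (≤-reflexive (+-identityʳ (bit (w (x , y))))) (bit≤1 (w (x , y)))
      ... | false = z≤n

      incidence-edge≤ : ∀ {u u′ : Fin n} v → toℕ u < toℕ u′ → colorW ((vG u , vG u′) ∷ []) w (vG v) ≤
        bit (does (u Fin.≟ v)) * bit (does (v Fin.<? u′)) + bit (does (u′ Fin.≟ v)) * bit (does (u Fin.<? v))
      incidence-edge≤ {u} {u′} v u<u′ with u Fin.≟ v | u′ Fin.≟ v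
      ... | yes refl | _ rewrite dec-true (u Fin.<? u′) u<u′ = ≤-trans (single-edge≤1 {vG u} {vG u′} {vG u}) (m≤m+n 1 _)
      ... | no _ | yes refl rewrite dec-true (u Fin.<? u′) u<u′ = single-edge≤1 {vG u} {vG u′} {vG u′}
      ... | no u≢v | no u′≢v =
        ≤-reflexive (cong (_+ 0) (incidentWeight-≢ w (u≢v ∘ vG-injective ∘ sym) (u′≢v ∘ vG-injective ∘ sym)))

      -- edgesG lists each edge once, as (u, u′) with u < u′.
      incidence≤ : ∀ u u′ v → colorW (edgeOf u u′) w (vG v) ≤
        bit (does (u Fin.≟ v)) * bit (does (v Fin.<? u′)) + bit (does (u′ Fin.≟ v)) * bit (does (u Fin.<? v))
      incidence≤ u u′ v with adj G u u′ ∧ (toℕ u <ᵇ toℕ u′) in present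
      ... | false = z≤n
      ... | true  = incidence-edge≤ v (<ᵇ⇒< (toℕ u) (toℕ u′) (T-∧ .Equivalence.to (subst T (sym present) _) .proj₂))

      δ lt : Fin n → Fin n → ℕ
      δ  x y = bit (does (x Fin.≟ y))
      lt x y = bit (does (x Fin.<? y))

      δ-refl : ∀ v → δ v v ≡ 1
      δ-refl v = cong bit (dec-true (v Fin.≟ v) refl)

      δ-≢ : ∀ {u v} → u ≢ v → δ u v ≡ 0
      δ-≢ {u} {v} u≢v = cong bit (dec-false (u Fin.≟ v) u≢v)

      exactly-one : ∀ v x → lt v x + lt x v + δ x v ≡ 1
      exactly-one v x with Fin.<-cmp v x
      ... | tri< v<x _ x≮v rewrite dec-true (v Fin.<? x) v<x | dec-false (x Fin.<? v) x≮v | dec-false (x Fin.≟ v) (λ { refl → x≮v v<x }) = refl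
      ... | tri≈ v≮x refl x≮v rewrite dec-false (v Fin.<? x) v≮x | dec-true (x Fin.≟ x) refl = refl
      ... | tri> v≮x _ x<v rewrite dec-false (v Fin.<? x) v≮x | dec-true (x Fin.<? v) x<v | dec-false (x Fin.≟ v) (λ { refl → v≮x x<v }) = refl

      vertices = allFin n

      Σδ≡1 : ∀ v → sumOver vertices (λ x → δ x v) ≡ 1
      Σδ≡1 v = trans (sumOver-single (Unique.allFin⁺ n) (∈-allFin v) (λ x _ → δ-≢)) (δ-refl v)

      Σlt≡n∸1 : ∀ v → sumOver vertices (λ x → lt v x + lt x v) ≡ n ∸ 1
      Σlt≡n∸1 v = begin
        sumOver vertices (λ x → lt v x + lt x v)                               ≡⟨ m+n∸n≡m _ 1 ⟨
        sumOver vertices (λ x → lt v x + lt x v) + 1 ∸ 1                       ≡⟨ cong (λ m → sumOver vertices (λ x → lt v x + lt x v) + m ∸ 1) (Σδ≡1 v) ⟨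
        sumOver vertices (λ x → lt v x + lt x v) + sumOver vertices (λ x → δ x v) ∸ 1 ≡⟨ cong (_∸ 1) (sumOver-+ vertices (λ x → lt v x + lt x v) (λ x → δ x v)) ⟨
        sumOver vertices (λ x → lt v x + lt x v + δ x v) ∸ 1                   ≡⟨ cong (_∸ 1) (sumOver-const vertices 1 (λ x _ → exactly-one v x)) ⟩
        length vertices * 1 ∸ 1                                                ≡⟨ cong (_∸ 1) (trans (*-identityʳ (length vertices)) (length-tabulate {n = n} id)) ⟩
        n ∸ 1                                                             ∎
        where open ≡-Reasoning

    edgesG-degree≤ : ∀ v → colorW edgesG w (vG v) ≤ n ∸ 1
    edgesG-degree≤ v = begin
      colorW edgesG w (vG v)
        ≡⟨ trans (colorW-concatMap w {vG v} _ vertices) (sumOver-cong vertices (λ u _ → colorW-concatMap w {vG v} (edgeOf u) vertices)) ⟩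
      sumOver vertices (λ u → sumOver vertices (λ u′ → colorW (edgeOf u u′) w (vG v)))
        ≤⟨ sumOver-mono-≤ vertices (λ u _ → sumOver-mono-≤ vertices (λ u′ _ → incidence≤ u u′ v)) ⟩
      sumOver vertices (λ u → sumOver vertices (λ u′ → δ u v * lt v u′ + δ u′ v * lt u v))
        ≡⟨ trans (sumOver-cong vertices (λ u _ → sumOver-+ vertices _ _)) (sumOver-+ vertices _ _) ⟩
      sumOver vertices (λ u → sumOver vertices (λ u′ → δ u v * lt v u′)) + sumOver vertices (λ u → sumOver vertices (λ u′ → δ u′ v * lt u v))
        ≡⟨ cong₂ _+_ (sumOver-single (Unique.allFin⁺ n) (∈-allFin v) (λ u _ u≢v → sumOver-zero vertices (λ u′ _ → cong (_* lt v u′) (δ-≢ u≢v))))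
                     (sumOver-cong vertices (λ u _ → sumOver-single (Unique.allFin⁺ n) (∈-allFin v) (λ u′ _ u′≢v → cong (_* lt u v) (δ-≢ u′≢v)))) ⟩
      sumOver vertices (λ u′ → δ v v * lt v u′) + sumOver vertices (λ u → δ v v * lt u v)
        ≡⟨ cong₂ _+_ (sumOver-cong vertices (λ u′ _ → trans (cong (_* lt v u′) (δ-refl v)) (+-identityʳ _)))
                     (sumOver-cong vertices (λ u _ → trans (cong (_* lt u v) (δ-refl v)) (+-identityʳ _))) ⟩
      sumOver vertices (lt v) + sumOver vertices (λ x → lt x v)
        ≡⟨ sumOver-+ vertices (lt v) (λ x → lt x v) ⟨
      sumOver vertices (λ x → lt v x + lt x v)
        ≡⟨ Σlt≡n∸1 v ⟩
      n ∸ 1 ∎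
      where open ≤-Reasoning

  1+[N+i∸1]≡N+i : ∀ {i} → i ∈ range 1 N → suc (N + i ∸ 1) ≡ N + i
  1+[N+i∸1]≡N+i {i} i∈ = trans (+-comm 1 _) (m∸n+n≡m (≤-trans (proj₁ (∈-range⁻ i∈)) (m≤n+m i N)))

  bigN≡n*[n²+n∸1] : N ≡ n * (n ^ 2 + n ∸ 1)
  bigN≡n*[n²+n∸1] = sym (begin
    n * (n ^ 2 + n ∸ 1)         ≡⟨ *-distribˡ-∸ n (n ^ 2 + n) 1 ⟩
    n * (n ^ 2 + n) ∸ n * 1     ≡⟨ cong₂ _∸_ (*-distribˡ-+ n (n ^ 2) n) (*-identityʳ n) ⟩
    n ^ 3 + n * n ∸ n           ≡⟨ cong (λ m → n ^ 3 + n * m ∸ n) (*-identityʳ n) ⟨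
    N                           ∎)
    where open ≡-Reasoning

  module _ (bounded : ∀ v → All (λ k → (2 ≤ k) × (k ≤ n ^ 2 + 1)) (L v)) (nonempty : ∃ λ v → L v ≢ []) where

    ∈L⇒≤t : ∀ {v x} → x ∈ L v → x ≤ t
    ∈L⇒≤t {v} x∈ = ≤-foldr-⊔ (∈-concatMap⁺ L (lose (∈-allFin v) x∈))

    t≤n²+1 : t ≤ n ^ 2 + 1
    t≤n²+1 = foldr-⊔-≤ (concat⁺ (map⁺ (All.universal (λ v → All.map proj₂ (bounded v)) (allFin n))))

    2≤t : 2 ≤ t
    2≤t with x , x∈ ← ≢[]⇒∃∈ (proj₂ nonempty) = ≤-trans (proj₁ (All.lookup (bounded _) x∈)) (∈L⇒≤t x∈)

    1≤n : 1 ≤ n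
    1≤n = ≤-trans (s≤s z≤n) (Fin.toℕ<n (proj₁ nonempty))

    t+n∸1≤n²+n : t + n ∸ 1 ≤ n ^ 2 + n
    t+n∸1≤n²+n = ≤-trans (∸-monoˡ-≤ 1 (+-monoˡ-≤ n t≤n²+1))
                         (≤-reflexive (cong (_∸ 1) (trans (+-assoc (n ^ 2) 1 n) (+-suc (n ^ 2) n))))

    private
      X : ℕ
      X = n ^ 2 + n ∸ 1

    n²+n≤N : 2 ≤ n → n ^ 2 + n ≤ N
    n²+n≤N 2≤n = begin
      n ^ 2 + n   ≡⟨ m∸n+n≡m 1≤n²+n ⟨
      X + 1       ≤⟨ +-monoʳ-≤ X (∸-monoˡ-≤ 1 2≤n²+n) ⟩
      X + X       ≡⟨ cong (X +_) (+-identityʳ X) ⟨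
      2 * X       ≤⟨ *-monoˡ-≤ X 2≤n ⟩
      n * X       ≡⟨ bigN≡n*[n²+n∸1] ⟨
      N           ∎
      where
      open ≤-Reasoning
      2≤n²+n = ≤-trans 2≤n (m≤n+m n (n ^ 2))
      1≤n²+n = ≤-trans (s≤s z≤n) 2≤n²+n

    1≤N : 1 ≤ N
    1≤N = begin
      1      ≤⟨ ∸-monoˡ-≤ 1 (+-mono-≤ (*-mono-≤ 1≤n (*-mono-≤ 1≤n (≤-refl {1}))) 1≤n) ⟩
      X      ≡⟨ *-identityˡ X ⟨
      1 * X  ≤⟨ *-monoˡ-≤ X 1≤n ⟩
      n * X  ≡⟨ bigN≡n*[n²+n∸1] ⟨
      N      ∎
      where open ≤-Reasoning

    missing≤N : ∀ {v k} → k ∈ missing v → k ≤ N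
    missing≤N {v} {k} k∈ with ∈-missing⁻ k∈ | m≤n⇒m<n∨m≡n 1≤n
    ... | (_ , k≤) , _ | inj₁ 2≤n = ≤-trans k≤ (≤-trans t+n∸1≤n²+n (n²+n≤N 2≤n))
    -- For n = 1 we have N = 1, but then the only list is {2} and no colour is missing.
    ... | (2≤k , k≤) , k∉L | inj₂ 1≡n = ⊥-elim (k∉L (subst (_∈ L v) x≡k x∈L))
      where
      witness = ≢[]⇒∃∈ (proj₂ nonempty)
      x = proj₁ witness
      only-vertex : ∀ (u : Fin n) → u ≡ v
      only-vertex u = toℕ-injective (trans (toℕ≡0 u) (sym (toℕ≡0 v)))
        where toℕ≡0 : ∀ (u : Fin n) → toℕ u ≡ 0
              toℕ≡0 u = n<1⇒n≡0 (subst (toℕ u <_) (sym 1≡n) (Fin.toℕ<n u))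
      x∈L : x ∈ L v
      x∈L = subst (λ u → x ∈ L u) (only-vertex (proj₁ nonempty)) (proj₂ witness)
      n²+1≡2 : n ^ 2 + 1 ≡ 2
      n²+1≡2 = cong (λ m → m ^ 2 + 1) (sym 1≡n)
      t≤2 : t ≤ 2
      t≤2 = subst (t ≤_) n²+1≡2 t≤n²+1
      x≡k : x ≡ k
      x≡k = trans (≤-antisym (subst (x ≤_) n²+1≡2 (proj₂ (All.lookup (bounded v) x∈L))) (proj₁ (All.lookup (bounded v) x∈L)))
                  (≤-antisym 2≤k (≤-trans (subst (λ m → k ≤ t + m ∸ 1) (sym 1≡n) k≤) (≤-trans (≤-reflexive (m+n∸n≡m t 1)) t≤2)))

    Σ-length-missing≤N : sumOver (allFin n) (λ v → length (missing v)) ≤ N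
    Σ-length-missing≤N = begin
      sumOver (allFin n) (λ v → length (missing v))   ≤⟨ sumOver-mono-≤ (allFin n) (λ v _ → ≤-trans (length-missing≤ v) (∸-monoˡ-≤ 1 t+n∸1≤n²+n)) ⟩
      sumOver (allFin n) (λ _ → X)                    ≡⟨ sumOver-const (allFin n) X (λ _ _ → refl) ⟩
      length (allFin n) * X                           ≡⟨ cong (_* X) (length-tabulate {n = n} id) ⟩
      n * X                                           ≡⟨ bigN≡n*[n²+n∸1] ⟨
      N                                               ∎
      where open ≤-Reasoning

    -- From a proper weighting to a list colouring

    module FromWeighting (w : Edge → Bool) (proper : ProperWeighting (edgesH G L) w) where
      open Colors w

      -- Without weight on the hub edge, both vertices of the suspended path get colour w(c, d).
      hub-edge-forced : ∀ {h m j} → Hub h m → j < m → w (h , vC h j) ≡ true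
      hub-edge-forced {h} {m} {j} hub j<m with w (h , vC h j) in w≡
      ... | true  = refl
      ... | false = ⊥-elim (proper (suspendedPaths⊆edgesH hub (legEdge∈suspendedPaths h m j<m))
                                   (trans (colorH-vC hub j<m) (trans (cong (λ b → bit b + bit (w (vC h j , vD h j))) w≡) (sym (colorH-vD hub j<m)))))

      colorW-hub : ∀ {h m} → Hub h m → colorW (suspendedPaths h m) w h ≡ m
      colorW-hub {h} {m} hub = trans (colorW-suspendedPaths-hub h m w)
        (trans (sumOver-bit-true (upTo m) (λ j j∈ → hub-edge-forced hub (∈-upTo⁻ j∈))) (length-upTo m))

      colorH-vA-forced : ∀ {i} → i ∈ range 1 N → colorH (vA i) ≡ bit (w (vZ , vA i)) + (bit (w (vA i , vB i)) + (N + i ∸ 1))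
      colorH-vA-forced {i} i∈ =
        trans (colorH-vA i∈) (cong (λ c → bit (w (vZ , vA i)) + (bit (w (vA i , vB i)) + c)) (colorW-hub (a-hub i∈)))

      colorH-vB-forced : ∀ {i} → i ∈ range 1 N → colorH (vB i) ≡ bit (w (vZ , vB i)) + (bit (w (vA i , vB i)) + (N + i ∸ 1))
      colorH-vB-forced {i} i∈ =
        trans (colorH-vB i∈) (cong (λ c → bit (w (vZ , vB i)) + (bit (w (vA i , vB i)) + c)) (colorW-hub (b-hub i∈)))

      triangle-forced : ∀ za zb ab m → bit za + (bit ab + m) ≢ bit zb + (bit ab + m) →
                        bit za + bit zb ≡ 1 × (bit za + (bit ab + m) ≡ suc m ⊎ bit zb + (bit ab + m) ≡ suc m)
      triangle-forced true  true  _     m a≢b = ⊥-elim (a≢b refl)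
      triangle-forced false false _     m a≢b = ⊥-elim (a≢b refl)
      triangle-forced true  false true  m _   = refl , inj₂ refl
      triangle-forced true  false false m _   = refl , inj₁ refl
      triangle-forced false true  true  m _   = refl , inj₁ refl
      triangle-forced false true  false m _   = refl , inj₂ refl

      gadget-forced : ∀ {i} → i ∈ range 1 N →
        bit (w (vZ , vA i)) + bit (w (vZ , vB i)) ≡ 1 × (colorH (vA i) ≡ N + i ⊎ colorH (vB i) ≡ N + i)
      gadget-forced {i} i∈ with triangle-forced (w (vZ , vA i)) (w (vZ , vB i)) (w (vA i , vB i)) (N + i ∸ 1)
        (λ eq → proper (gadget⊆edgesH i∈ (there (there (here refl)))) (trans (colorH-vA-forced i∈) (trans eq (sym (colorH-vB-forced i∈)))))
      ... | sum≡1 , inj₁ a≡ = sum≡1 , inj₁ (trans (colorH-vA-forced i∈) (trans a≡ (1+[N+i∸1]≡N+i i∈)))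
      ... | sum≡1 , inj₂ b≡ = sum≡1 , inj₂ (trans (colorH-vB-forced i∈) (trans b≡ (1+[N+i∸1]≡N+i i∈)))

      pathEnds : ℕ
      pathEnds = sumOver (allFin n) (λ v → sumOver (missing v) (λ k → bit (w (endNeighbour (vG v) (interior v k) , vZ))))

      colorH-vZ-forced : colorH vZ ≡ N + pathEnds
      colorH-vZ-forced = trans colorH-vZ (cong (_+ pathEnds)
        (trans (sumOver-const (range 1 N) 1 (λ i i∈ → proj₁ (gadget-forced i∈))) (trans (*-identityʳ _) (length-range 1 N))))

      pathEnds≤N : pathEnds ≤ N
      pathEnds≤N = ≤-trans (sumOver-mono-≤ (allFin n) (λ v _ → sumOver-bit≤length (missing v) _)) Σ-length-missing≤N

      -- An excess i ≥ 1 at z would equal the colour N + i of a_i or b_i.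
      pathEnds≡0 : pathEnds ≡ 0
      pathEnds≡0 with pathEnds in eq
      ... | zero  = refl
      ... | suc x = ⊥-elim (clash (proj₂ (gadget-forced i∈)))
        where
        i∈ : suc x ∈ range 1 N
        i∈ = ∈-range⁺ (s≤s z≤n) (≤-trans (≤-reflexive (sym eq)) pathEnds≤N)
        colorZ : colorH vZ ≡ N + suc x
        colorZ = trans colorH-vZ-forced (cong (N +_) eq)
        clash : colorH (vA (suc x)) ≡ N + suc x ⊎ colorH (vB (suc x)) ≡ N + suc x → ⊥
        clash (inj₁ a≡) = proper (gadget⊆edgesH i∈ (here refl)) (trans colorZ (sym a≡))
        clash (inj₂ b≡) = proper (gadget⊆edgesH i∈ (there (here refl))) (trans colorZ (sym b≡))

      colorH-vZ≡N : colorH vZ ≡ N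
      colorH-vZ≡N = trans colorH-vZ-forced (trans (cong (N +_) pathEnds≡0) (+-identityʳ N))

      spine-forced : ∀ {v k} → k ∈ missing v → let x₁ = startNeighbour (interior v k) vZ in
                     w (vG v , x₁) ≡ false × colorH x₁ ≡ k
      spine-forced {v} {k} k∈ = pathEdges-forced colorH w (vX v k ∘ suc) (N ∸ k) k
        (applyUpTo⁺₂ _ (N ∸ k) (λ _ ())) (applyUpTo⁺₂ _ (N ∸ k) (λ _ ())) (interior-unique v k)
        (λ xy∈ → proper (xPath⊆edgesH k∈ (spine⊆xPath xy∈)))
        interior-colour
        (trans colorH-vZ≡N (sym (m+[n∸m]≡n (missing≤N k∈))))
        (bit≡0⇒false (sumOver≡0⇒ (missing v) (sumOver≡0⇒ (allFin n) pathEnds≡0 (∈-allFin v)) k∈))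
        where
        interior-colour : ∀ i → i < N ∸ k → colorH (vX v k (suc i)) ≡ colorW (spine v k) w (vX v k (suc i)) + (k + i)
        interior-colour i i< = trans (colorH-vX k∈ i<) (cong (colorW (spine v k) w (vX v k (suc i)) +_)
          (colorW-hub (subst (λ m → Hub (vX v k (suc i)) (m ∸ 1)) (+-suc k i) (x-hub k∈ (∈-range⁺ (s≤s z≤n) i<)))))

      coloring : Fin n → ℕ
      coloring v = colorH (vG v)

      coloring≡ : ∀ v → coloring v ≡ colorW edgesG w (vG v) + (colorW (pendants (vG v) (t ∸ 2)) w (vG v) + 2)
      coloring≡ v = trans (colorH-vG v) (cong (colorW edgesG w (vG v) +_) (cong₂ _+_
        (sumOver-zero (missing v) (λ k k∈ → cong bit (proj₁ (spine-forced k∈))))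
        (cong (colorW (pendants (vG v) (t ∸ 2)) w (vG v) +_) (colorW-hub (g-hub v)))))

      2≤coloring : ∀ v → 2 ≤ coloring v
      2≤coloring v = ≤-trans (≤-trans (m≤n+m 2 (colorW (pendants (vG v) (t ∸ 2)) w (vG v))) (m≤n+m _ (colorW edgesG w (vG v))))
                              (≤-reflexive (sym (coloring≡ v)))

      coloring≤ : ∀ v → coloring v ≤ t + n ∸ 1
      coloring≤ v = begin
        coloring v                                                          ≡⟨ coloring≡ v ⟩
        colorW edgesG w (vG v) + (colorW (pendants (vG v) (t ∸ 2)) w (vG v) + 2) ≤⟨ +-mono-≤ (edgesG-degree≤ w v) (+-monoˡ-≤ 2 pendants≤) ⟩
        (n ∸ 1) + (t ∸ 2 + 2)                                                ≡⟨ cong ((n ∸ 1) +_) (m∸n+n≡m 2≤t) ⟩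
        (n ∸ 1) + t                                                          ≡⟨ +-comm (n ∸ 1) t ⟩
        t + (n ∸ 1)                                                          ≡⟨ +-∸-assoc t 1≤n ⟨
        t + n ∸ 1                                                            ∎
        where
        open ≤-Reasoning
        pendants≤ : colorW (pendants (vG v) (t ∸ 2)) w (vG v) ≤ t ∸ 2
        pendants≤ = ≤-trans (≤-reflexive (colorW-pendants-hub (vG v) (t ∸ 2) w))
                            (≤-trans (sumOver-bit≤length (upTo (t ∸ 2)) _) (≤-reflexive (length-upTo (t ∸ 2))))

      coloring≢missing : ∀ {v k} → k ∈ missing v → coloring v ≢ k
      coloring≢missing {v} {k} k∈ eq =
        proper (xPath⊆edgesH k∈ (spine⊆xPath (startEdge∈pathEdges (vG v) (interior v k) vZ)))
               (trans eq (sym (proj₂ (spine-forced k∈))))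

      coloring∈L : ∀ v → coloring v ∈ L v
      coloring∈L v with T? (elemᵇ (coloring v) (L v))
      ... | yes listed   = elemᵇ⇒∈ _ (L v) listed
      ... | no unlisted  = ⊥-elim (coloring≢missing (∈-missing⁺ (2≤coloring v) (coloring≤ v) (unlisted ∘ ∈⇒elemᵇ)) refl)

      coloring-proper : ∀ u v → adj G u v ≡ true → coloring u ≢ coloring v
      coloring-proper u v uv∈G with Fin.<-cmp u v
      ... | tri< u<v _ _ = proper (adjacent⇒∈edgesH uv∈G u<v)
      ... | tri≈ _ refl _ = ⊥-elim (true≢false (trans (sym uv∈G) (Graph.irrefl G u)))
        where true≢false : true ≢ false
              true≢false ()
      ... | tri> _ _ v<u = proper (adjacent⇒∈edgesH (trans (Graph.sym G v u) uv∈G) v<u) ∘ sym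

      listColorable : ListColorable G L
      listColorable = coloring , coloring∈L , coloring-proper

    -- From a list colouring to a proper weighting

    module FromColoring (c : Fin n → ℕ) (isColoring : IsListColoring G L c) where

      2≤c : ∀ v → 2 ≤ c v
      2≤c v = proj₁ (All.lookup (bounded v) (proj₁ isColoring v))

      c≤t : ∀ v → c v ≤ t
      c≤t v = ∈L⇒≤t (proj₁ isColoring v)

      -- c on the index toℕ v used in vertex names; indices ≥ n get the junk value 0.
      cIndex : ℕ → ℕ
      cIndex a with a <? n
      ... | yes a<n = c (fromℕ< a<n)
      ... | no _    = 0

      cIndex-toℕ : ∀ v → cIndex (toℕ v) ≡ c v
      cIndex-toℕ v with toℕ v <? n
      ... | yes v<n = cong c (Fin.fromℕ<-toℕ v v<n)
      ... | no v≮n  = ⊥-elim (v≮n (Fin.toℕ<n v))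

      -- Resulting colours: z ↦ N, a_i ↦ N + i + 1, b_i ↦ N + i, x^{v,k}_i ↦ k + i - 1, v ↦ c(v),
      -- and 1, 0 on the two new vertices of each suspended path.
      W : Edge → Bool
      W (_ , 6 ∷ _)              = true
      W (0 ∷ a ∷ [] , 5 ∷ j ∷ _) = j <ᵇ cIndex a ∸ 2
      W (1 ∷ [] , 2 ∷ _)         = true
      W (2 ∷ _ , 3 ∷ _)          = true
      W _                        = false

      open Colors W

      colorW-hub : ∀ h m → colorW (suspendedPaths h m) W h ≡ m
      colorW-hub h m = trans (colorW-suspendedPaths-hub h m W) (trans (sumOver-bit-true (upTo m) (λ _ _ → refl)) (length-upTo m))

      legs-proper : ∀ {h m} → Hub h m → 2 ≤ colorH h → ProperOn colorH (suspendedPaths h m)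
      legs-proper {h} {m} hub 2≤h xy∈ with ∈-suspendedPaths⁻ h m xy∈
      ... | j , j<m , inj₁ refl = λ eq → <⇒≢ 2≤h (sym (trans eq (colorH-vC hub j<m)))
      ... | j , j<m , inj₂ refl = λ eq → 1+n≢n (trans (sym (colorH-vC hub j<m)) (trans eq (colorH-vD hub j<m)))

      spine-unweighted : ∀ {v k e} → e ∈ spine v k → W e ≡ false
      spine-unweighted {v} {k} {x , y} e∈ with ∈-pathEdges⁻ (vG v) (interior v k) vZ e∈
      ... | inj₁ refl = refl
      ... | inj₂ y∈ with ∈-applyUpTo⁻ (vX v k ∘ suc) y∈
      ...   | _ , _ , refl = refl

      edgesG-unweighted : ∀ {e} → e ∈ edgesG → W e ≡ false
      edgesG-unweighted {x , y} e∈ with ∈-edgesG⁻ e∈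
      ... | _ , _ , _ , refl , refl = refl

      colorH-vZ≡N : colorH vZ ≡ N
      colorH-vZ≡N = trans colorH-vZ (trans (cong₂ _+_
        (trans (sumOver-const (range 1 N) 1 (λ _ _ → refl)) (trans (*-identityʳ _) (length-range 1 N)))
        (sumOver-zero (allFin n) (λ v _ → sumOver-zero (missing v) (λ _ _ → refl))))
        (+-identityʳ N))

      colorH-vA≡1+N+i : ∀ {i} → i ∈ range 1 N → colorH (vA i) ≡ suc (N + i)
      colorH-vA≡1+N+i {i} i∈ = trans (colorH-vA i∈) (cong suc (trans (cong suc (colorW-hub (vA i) (N + i ∸ 1))) (1+[N+i∸1]≡N+i i∈)))

      colorH-vB≡N+i : ∀ {i} → i ∈ range 1 N → colorH (vB i) ≡ N + i
      colorH-vB≡N+i {i} i∈ = trans (colorH-vB i∈) (trans (cong suc (colorW-hub (vB i) (N + i ∸ 1))) (1+[N+i∸1]≡N+i i∈))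

      colorH-vX≡k+j : ∀ {v k j} → k ∈ missing v → j < N ∸ k → colorH (vX v k (suc j)) ≡ k + j
      colorH-vX≡k+j {v} {k} {j} k∈ j< = trans (colorH-vX k∈ j<)
        (cong₂ _+_ (colorW-≡0 W {vX v k (suc j)} (spine v k) (λ {e} e∈ → incidentWeight-false W {vX v k (suc j)} {e} (spine-unweighted e∈))) (colorW-hub (vX v k (suc j)) (k + j)))

      colorH-vG≡c : ∀ v → colorH (vG v) ≡ c v
      colorH-vG≡c v = begin
        colorH (vG v)
          ≡⟨ colorH-vG v ⟩
        colorW edgesG W (vG v) + (sumOver (missing v) (λ k → bit (W (vG v , startNeighbour (interior v k) vZ)))
                                 + (colorW (pendants (vG v) (t ∸ 2)) W (vG v) + colorW (suspendedPaths (vG v) 2) W (vG v)))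
          ≡⟨ cong₂ _+_ (colorW-≡0 W {vG v} edgesG (λ {e} e∈ → incidentWeight-false W {vG v} {e} (edgesG-unweighted e∈)))
                       (cong₂ _+_ (sumOver-zero (missing v) (λ k _ → cong bit (spine-unweighted (startEdge∈pathEdges (vG v) (interior v k) vZ))))
                                  (cong₂ _+_ pendants≡ (colorW-hub (vG v) 2))) ⟩
        c v ∸ 2 + 2
          ≡⟨ m∸n+n≡m (2≤c v) ⟩
        c v ∎
        where
        open ≡-Reasoning
        pendants≡ : colorW (pendants (vG v) (t ∸ 2)) W (vG v) ≡ c v ∸ 2
        pendants≡ = begin
          colorW (pendants (vG v) (t ∸ 2)) W (vG v)                 ≡⟨ colorW-pendants-hub (vG v) (t ∸ 2) W ⟩
          sumOver (upTo (t ∸ 2)) (λ j → bit (j <ᵇ cIndex (toℕ v) ∸ 2))  ≡⟨ sumOver-upTo-<ᵇ (t ∸ 2) (cIndex (toℕ v) ∸ 2) ⟩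
          (t ∸ 2) ⊓ (cIndex (toℕ v) ∸ 2)                                ≡⟨ cong (λ a → (t ∸ 2) ⊓ (a ∸ 2)) (cIndex-toℕ v) ⟩
          (t ∸ 2) ⊓ (c v ∸ 2)                                       ≡⟨ m≥n⇒m⊓n≡n (∸-monoˡ-≤ 2 (c≤t v)) ⟩
          c v ∸ 2                                                   ∎

      edgesG-proper : ProperOn colorH edgesG
      edgesG-proper xy∈ with ∈-edgesG⁻ xy∈
      ... | u , v , uv∈G , refl , refl = λ eq → proj₂ isColoring u v uv∈G (trans (sym (colorH-vG≡c u)) (trans eq (colorH-vG≡c v)))

      gadget-proper : ∀ {i} → i ∈ range 1 N → ProperOn colorH (gadget i)
      gadget-proper {i} i∈ (here refl) eq = m≢1+m+n N (trans (sym colorH-vZ≡N) (trans eq (colorH-vA≡1+N+i i∈)))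
      gadget-proper {i} i∈ (there (here refl)) eq = <⇒≢ (m<m+n N (proj₁ (∈-range⁻ i∈))) (trans (sym colorH-vZ≡N) (trans eq (colorH-vB≡N+i i∈)))
      gadget-proper {i} i∈ (there (there (here refl))) eq = 1+n≢n (trans (sym (colorH-vA≡1+N+i i∈)) (trans eq (colorH-vB≡N+i i∈)))
      gadget-proper {i} i∈ (there (there (there xy∈))) with ∈-++⁻ (suspendedPaths (vA i) (N + i ∸ 1)) xy∈
      ... | inj₁ xy∈A = legs-proper (a-hub i∈) (≤-trans 2≤N+i (≤-trans (n≤1+n _) (≤-reflexive (sym (colorH-vA≡1+N+i i∈))))) xy∈A
        where 2≤N+i = +-mono-≤ 1≤N (proj₁ (∈-range⁻ i∈))
      ... | inj₂ xy∈B = legs-proper (b-hub i∈) (≤-trans 2≤N+i (≤-reflexive (sym (colorH-vB≡N+i i∈)))) xy∈B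
        where 2≤N+i = +-mono-≤ 1≤N (proj₁ (∈-range⁻ i∈))

      xPath-proper : ∀ {v k} → k ∈ missing v → ProperOn colorH (xPath v k)
      xPath-proper {v} {k} k∈ = subst (ProperOn colorH) (sym (xPath≡spine++spineLegs v k)) (properOn-++ spine-proper spineLegs-proper)
        where
        c≢k : colorH (vG v) ≢ k
        c≢k eq = proj₂ (∈-missing⁻ k∈) (subst (_∈ L v) (trans (sym (colorH-vG≡c v)) eq) (proj₁ isColoring v))
        spine-proper : ProperOn colorH (spine v k)
        spine-proper = pathEdges-ascending-proper colorH (vX v k ∘ suc) (N ∸ k) k c≢k (λ j j< → colorH-vX≡k+j k∈ j<)
                         (trans colorH-vZ≡N (sym (m+[n∸m]≡n (missing≤N k∈))))
        spineLegs-proper : ProperOn colorH (spineLegs v k)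
        spineLegs-proper = properOn-concatMap (λ i → suspendedPaths (vX v k i) (k + i ∸ 1)) hub-proper
          where
          hub-proper : ∀ i → i ∈ range 1 (N ∸ k) → ProperOn colorH (suspendedPaths (vX v k i) (k + i ∸ 1))
          hub-proper zero    i∈ = ⊥-elim (1+n≰n (proj₁ (∈-range⁻ i∈)))
          hub-proper (suc j) i∈ = legs-proper (x-hub k∈ i∈)
            (≤-trans (proj₁ (proj₁ (∈-missing⁻ k∈))) (≤-trans (m≤m+n k j) (≤-reflexive (sym (colorH-vX≡k+j k∈ (proj₂ (∈-range⁻ i∈)))))))

      vertexGadget-proper : ∀ v → ProperOn colorH (vertexGadget v)
      vertexGadget-proper v = properOn-++ pendants-proper (legs-proper (g-hub v) (≤-trans (2≤c v) (≤-reflexive (sym (colorH-vG≡c v)))))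
        where
        pendants-proper : ProperOn colorH (pendants (vG v) (t ∸ 2))
        pendants-proper xy∈ with ∈-pendants⁻ (vG v) (t ∸ 2) xy∈
        ... | j , j< , refl = λ eq → <⇒≢ (≤-trans (s≤s (≤-trans (≤-reflexive (colorH-pendant j<)) (bit≤1 _))) (2≤c v))
                                          (trans (sym eq) (colorH-vG≡c v))

      weighting-proper : ProperWeighting (edgesH G L) W
      weighting-proper = properOn-++ {E = edgesG} edgesG-proper (properOn-++ {E = gadgets} (properOn-concatMap gadget (λ _ → gadget-proper))
        (properOn-++ {E = xPaths} (properOn-concatMap _ {allFin n} (λ v _ → properOn-concatMap (xPath v) (λ _ → xPath-proper)))
                     (properOn-concatMap vertexGadget {allFin n} (λ v _ → vertexGadget-proper v))))

mainTheorem9 : (n : ℕ) (G : Graph n) (L : ListAssignment n) →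
               (∀ v → All (λ k → (2 ≤ k) × (k ≤ n ^ 2 + 1)) (L v)) →
               (∃ λ v → L v ≢ []) →
               ListColorable G L ⇔ HasProperWeighting (edgesH G L)
mainTheorem9 n G L bounded nonempty = mk⇔
  (λ (c , isColoring) → let open FromColoring G L bounded nonempty c isColoring in W , weighting-proper)
  (λ (w , proper) → FromWeighting.listColorable G L bounded nonempty w proper)
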